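{- Let $t\ge 2$, $n_1,\dots,n_t\ge 1$, $n=n_1+\dots+n_t$, and let $G=K_{n_1,\dots,n_t}$ with partite sets $Y_1,\dots,Y_t$, $|Y_i|=n_i$. The minimal skew forcing sets of $G$ are exactly the sets of $n-2$ vertices such that the two omitted vertices lie in different partite sets; these are the vertices of $\mathfrak{Z}^-(G)$ of cardinality $n-2$, and each has degree two in $\mathfrak{Z}^-(G)$. Every set of $n-1$ vertices of $G$ is a vertex of $\mathfrak{Z}^-(G)$, and such a set has degree $n-n_i+1$ in $\mathfrak{Z}^-(G)$ when the omitted vertex lies in $Y_i$. Moreover, the skew TAR graph of a complete multipartite graph is unique: if $H$ is a graph with no isolated vertices and $\mathfrak{Z}^-(H)\cong\mathfrak{Z}^-(G)$, then $H\cong G$.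
   Context: All graphs are finite, simple, undirected. Skew color change rule: given the current set of blue vertices with white set $W$, any vertex $u$ (blue or white) may turn a white vertex $w$ blue if $w$ is the only white neighbor of $u$, i.e. $N(u)\cap W=\{w\}$. A skew forcing set is a set $S$ such that starting with exactly $S$ blue, repeated application makes every vertex blue. The skew TAR graph $\mathfrak{Z}^-(G)$ has the skew forcing sets of $G$ as vertices, two adjacent iff their symmetric difference has exactly one element. $K_{n_1,\dots,n_t}$ is the complete multipartite graph with parts of sizes $n_1,\dots,n_t$ (every pair of vertices in different parts is adjacent, no edges within parts). -}

module Defs where

open import Data.Nat using (ℕ; _+_; _∸_; _≤_)
open import Data.Bool using (Bool; true; false)
open import Data.Fin using (Fin; _≟_)
open import Relation.Nullary.Decidable using (⌊_⌋)
open import Data.Fin.Subset using (Subset; _∈_; _∉_; _⊆_; _∪_; _─_; ⁅_⁆; ∁; ⊤; ∣_∣)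
open import Data.Vec using (tabulate)
open import Data.List using (List; length)
open import Data.List.Relation.Unary.Unique.Propositional using (Unique)
import Data.List.Membership.Propositional as L
open import Data.Product using (Σ; Σ-syntax; ∃; ∃-syntax; _×_)
open import Relation.Binary.PropositionalEquality using (_≡_; _≢_)
open import Relation.Binary.Construct.Closure.ReflexiveTransitive using (Star)
open import Function.Bundles using (_⇔_; _↔_; Inverse)

record Graph (n : ℕ) : Set where
  field
    adj    : Fin n → Fin n → Bool
    sym    : ∀ u v → adj u v ≡ adj v u
    irrefl : ∀ u → adj u u ≡ false
open Graph public

N : ∀ {n} → Graph n → Fin n → Subset n
N G u = tabulate (adj G u)

-- One application of the skew color change rule: blue set B becomes B'.
-- Some vertex u (blue or white) has w as its only white neighbour.
SkewStep : ∀ {n} → Graph n → Subset n → Subset n → Set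
SkewStep G B B' = ∃[ u ] ∃[ w ]
  ( w ∈ N G u × w ∉ B
  × (∀ v → v ∈ N G u → v ∉ B → v ≡ w)
  × B' ≡ B ∪ ⁅ w ⁆ )

SkewForcing : ∀ {n} → Graph n → Subset n → Set
SkewForcing G S = Star (SkewStep G) S ⊤

MinimalSkewForcing : ∀ {n} → Graph n → Subset n → Set
MinimalSkewForcing G S = SkewForcing G S × (∀ T → T ⊆ S → SkewForcing G T → T ≡ S)

TARAdj : ∀ {n} → Subset n → Subset n → Set
TARAdj S T = ∣ (S ─ T) ∪ (T ─ S) ∣ ≡ 1

TARDegree : ∀ {n} → Graph n → Subset n → ℕ → Set
TARDegree {n} G S d = Σ[ L ∈ List (Subset n) ]
  ( Unique L × length L ≡ d
  × (∀ T → (T L.∈ L) ⇔ (SkewForcing G T × TARAdj S T)) )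

TARIso : ∀ {m n} → Graph m → Graph n → Set
TARIso {m} {n} H G = Σ[ f ∈ (Subset m → Subset n) ] Σ[ g ∈ (Subset n → Subset m) ]
  ( (∀ S → SkewForcing H S → SkewForcing G (f S) × g (f S) ≡ S)
  × (∀ T → SkewForcing G T → SkewForcing H (g T) × f (g T) ≡ T)
  × (∀ S S' → SkewForcing H S → SkewForcing H S' → TARAdj S S' ⇔ TARAdj (f S) (f S')) )

GraphIso : ∀ {m n} → Graph m → Graph n → Set
GraphIso H G = Σ[ φ ∈ (Fin _ ↔ Fin _) ]
  (∀ u v → adj H u v ≡ adj G (Inverse.to φ u) (Inverse.to φ v))

NoIsolatedVertices : ∀ {n} → Graph n → Set
NoIsolatedVertices G = ∀ u → ∃[ v ] adj G u v ≡ true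

PartiteSet : ∀ {n t} → (Fin n → Fin t) → Fin t → Subset n
PartiteSet part i = tabulate (λ v → ⌊ part v ≟ i ⌋)

OmitsTwoFromDifferentParts : ∀ {n t} → (Fin n → Fin t) → Subset n → Set
OmitsTwoFromDifferentParts part S = ∃[ u ] ∃[ v ] (part u ≢ part v × S ≡ ∁ (⁅ u ⁆ ∪ ⁅ v ⁆))

IsCompleteMultipartite : ∀ {n t} → Graph n → (part : Fin n → Fin t) → (ns : Fin t → ℕ) → Set
IsCompleteMultipartite G part ns =
  (∀ u v → (adj G u v ≡ true) ⇔ (part u ≢ part v))
  × (∀ i → ∣ PartiteSet part i ∣ ≡ ns i)

-- In a graph in which non-adjacent vertices are twins no skew force can hit a white pair of non-adjacent
-- vertices, nor a white triangle: the forcer would see a second white vertex of the pair, resp. be a twin of the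
-- two other triangle vertices. So a skew forcing set misses at most two vertices, and two missed vertices are
-- adjacent. Conversely, without isolated vertices V ∖ {a} is forcing, and so is V ∖ {a, b} as soon as some vertex
-- sees a but not b. This describes the skew TAR graph of K_{n₁,…,n_t} explicitly, and with it the minimal sets
-- and all degrees.
--
-- For uniqueness let H, without isolated vertices, have a TAR graph isomorphic to that of G. If H had non-twins
-- x ≁ y with z ~ x, z ≁ y, then V∖{x}, V∖{x,y}, V∖{z}, V∖{z,y} would all have TAR degree at least 3 and carry two
-- disjoint TAR edges, whereas in the TAR graph of G every edge between such sets contains V. So H has twin
-- non-neighbours as well, and one distinguishes where V(H) is sent: to V(G), and then V∖{x} ↦ V∖{π x} defines a
-- graph isomorphism π; to some V∖{w}, and then both graphs are stars; or to some V∖{a,b}, and then both graphs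
-- have at most two vertices.

module Submission where

open import Defs hiding (sym)
open import Data.Nat using (ℕ; zero; suc; pred; _+_; _∸_; _≤_; z≤n; s≤s)
open import Data.Nat.Properties using (m∸[m∸n]≡n; +-comm; ≤-trans; 1+n≢n; m≢1+n+m)
open import Data.Bool using (Bool; true; false; not; _∨_; _xor_)
import Data.Bool as Bool
open import Data.Bool.Properties using (not-involutive; ¬-not; ∨-zeroʳ; ∨-identityʳ)
open import Data.Fin using (Fin; zero; suc; _≟_)
import Data.Fin.Properties as Fin
open import Data.Fin.Properties using (any?)
import Data.Fin.Permutation as Perm
open import Data.Fin.Permutation using (_⟨$⟩ʳ_)
open import Data.Fin.Subset using (Subset; _∉_; _⊆_; _∪_; _─_; ⁅_⁆; ∁; ⊤; ∣_∣) renaming (⊥ to ∅)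
open import Data.Fin.Subset.Properties
  using (∣⁅x⁆∣≡1; ∣∁p∣≡n∸∣p∣; ∪-comm; ∪-assoc; ∪-identityˡ; ∪-identityʳ; p∪∁p≡⊤; p⊆q⇒∁p⊇∁q; p⊆p∪q; ⊆⊤; ∣⊤∣≡n)
open import Data.Vec using ([]; _∷_; lookup)
open import Data.Vec.Properties
  using (lookup-map; lookup-zipWith; lookup-replicate; tabulate∘lookup; tabulate-cong; lookup∘tabulate; []=⇒lookup; lookup⇒[]=)
open import Data.List using (List; []; _∷_; length)
import Data.List as List
open import Data.List.Properties using (length-map)
open import Data.List.Membership.Propositional using () renaming (_∈_ to _∈ₗ_)
open import Data.List.Membership.Propositional.Properties using (∈-map⁺; ∈-map⁻)
open import Data.List.Relation.Unary.Any using (here; there)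
import Data.List.Relation.Unary.All as All using ([]; _∷_; tabulate)
import Data.List.Relation.Unary.All.Properties as All using (map⁺)
open import Data.List.Relation.Unary.Unique.Propositional using (Unique)
import Data.List.Relation.Unary.Unique.Propositional.Properties as Unique using (map⁺)
open import Data.List.Relation.Unary.AllPairs using ([]; _∷_)
open import Data.Product using (∃-syntax; _×_; _,_; proj₁; proj₂)
open import Data.Sum using (_⊎_; inj₁; inj₂; [_,_]; [_,_]′)
open import Data.Empty using (⊥; ⊥-elim)
open import Function.Bundles using (_⇔_; mk⇔; Equivalence; mk↔ₛ′)
open import Relation.Nullary using (¬_; yes; no; ¬?; _×-dec_)
open import Relation.Nullary.Decidable using (⌊_⌋)
open import Relation.Binary.Construct.Closure.ReflexiveTransitive using (ε; _◅_)
open import Relation.Binary.PropositionalEquality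
  using (_≡_; _≢_; refl; sym; trans; cong; cong₂; subst; subst₂; ≢-sym; module ≡-Reasoning)

true≢false : true ≢ false
true≢false ()

xor≡false⇒≡ : ∀ a b → (a xor b) ≡ false → b ≡ a
xor≡false⇒≡ true  true  _ = refl
xor≡false⇒≡ false false _ = refl

xor≡true⇒≡not : ∀ a b → (a xor b) ≡ true → b ≡ not a
xor≡true⇒≡not true  false _ = refl
xor≡true⇒≡not false true  _ = refl

≡⇒xor≡false : ∀ a b → b ≡ a → (a xor b) ≡ false
≡⇒xor≡false true  true  _ = refl
≡⇒xor≡false false false _ = refl

≡not⇒xor≡true : ∀ a b → b ≡ not a → (a xor b) ≡ true
≡not⇒xor≡true true  false _ = refl
≡not⇒xor≡true false true  _ = refl

≡true⇔≡true⇒≡ : ∀ {a b : Bool} → (a ≡ true → b ≡ true) → (b ≡ true → a ≡ true) → a ≡ b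
≡true⇔≡true⇒≡ {true}  {b}     a⇒b _   = sym (a⇒b refl)
≡true⇔≡true⇒≡ {false} {true}  _   b⇒a = b⇒a refl
≡true⇔≡true⇒≡ {false} {false} _   _   = refl

infix 4 _≡ᵇ_
_≡ᵇ_ : ∀ {n} → Fin n → Fin n → Bool
x ≡ᵇ y = ⌊ x ≟ y ⌋

≡ᵇ-refl : ∀ {n} (x : Fin n) → (x ≡ᵇ x) ≡ true
≡ᵇ-refl x with x ≟ x
... | yes _   = refl
... | no x≢x = ⊥-elim (x≢x refl)

≡ᵇtrue⇒≡ : ∀ {n} {x y : Fin n} → (x ≡ᵇ y) ≡ true → x ≡ y
≡ᵇtrue⇒≡ {x = x} {y} x≡ᵇy with x ≟ y
... | yes x≡y = x≡y
... | no _    = ⊥-elim (true≢false (sym x≡ᵇy))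

≡⇒≡ᵇtrue : ∀ {n} {x y : Fin n} → x ≡ y → (x ≡ᵇ y) ≡ true
≡⇒≡ᵇtrue {x = x} refl = ≡ᵇ-refl x

≢⇒≡ᵇfalse : ∀ {n} {x y : Fin n} → x ≢ y → (x ≡ᵇ y) ≡ false
≢⇒≡ᵇfalse {x = x} {y} x≢y with x ≟ y
... | yes x≡y = ⊥-elim (x≢y x≡y)
... | no _    = refl

≡ᵇ-suc : ∀ {n} (x y : Fin n) → (suc x ≡ᵇ suc y) ≡ (x ≡ᵇ y)
≡ᵇ-suc x y with x ≟ y
... | yes _ = refl
... | no _  = refl

subset-ext : ∀ {n} {p q : Subset n} → (∀ x → lookup p x ≡ lookup q x) → p ≡ q
subset-ext {p = p} {q} h = trans (sym (tabulate∘lookup p)) (trans (tabulate-cong h) (tabulate∘lookup q))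

white-ext : ∀ {n} {S T : Subset n} → (∀ v → lookup S v ≡ false → lookup T v ≡ false) →
  (∀ v → lookup T v ≡ false → lookup S v ≡ false) → S ≡ T
white-ext {S = S} {T} S⇒T T⇒S = subset-ext pointwise
  where
  pointwise : ∀ v → lookup S v ≡ lookup T v
  pointwise v with lookup S v in S[v] | lookup T v in T[v]
  ... | true  | true  = refl
  ... | false | false = refl
  ... | true  | false = trans (sym S[v]) (T⇒S v T[v])
  ... | false | true  = trans (sym (S⇒T v S[v])) T[v]

lookup-⊤ : ∀ {n} (x : Fin n) → lookup ⊤ x ≡ true
lookup-⊤ x = lookup-replicate x true

lookup-∁ : ∀ {n} (p : Subset n) x → lookup (∁ p) x ≡ not (lookup p x)
lookup-∁ p x = lookup-map x not p

lookup-∪ : ∀ {n} (p q : Subset n) x → lookup (p ∪ q) x ≡ (lookup p x ∨ lookup q x)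
lookup-∪ p q x = lookup-zipWith _∨_ x p q

lookup-⁅⁆ : ∀ {n} (y x : Fin n) → lookup ⁅ y ⁆ x ≡ (x ≡ᵇ y)
lookup-⁅⁆ zero    zero    = refl
lookup-⁅⁆ zero    (suc x) = lookup-replicate x false
lookup-⁅⁆ (suc y) zero    = refl
lookup-⁅⁆ (suc y) (suc x) = trans (lookup-⁅⁆ y x) (sym (≡ᵇ-suc x y))

infixl 6 _△_
_△_ : ∀ {n} → Subset n → Subset n → Subset n
S △ T = (S ─ T) ∪ (T ─ S)

lookup-symDiff : ∀ {n} (S T : Subset n) x → lookup (S △ T) x ≡ (lookup S x xor lookup T x)
lookup-symDiff (true  ∷ S) (true  ∷ T) zero    = refl
lookup-symDiff (true  ∷ S) (false ∷ T) zero    = refl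
lookup-symDiff (false ∷ S) (true  ∷ T) zero    = refl
lookup-symDiff (false ∷ S) (false ∷ T) zero    = refl
lookup-symDiff (s ∷ S)     (t ∷ T)     (suc x) = lookup-symDiff S T x

lookup≡false⇒∉ : ∀ {n} {x : Fin n} {p} → lookup p x ≡ false → x ∉ p
lookup≡false⇒∉ p[x] x∈p = true≢false (trans (sym ([]=⇒lookup x∈p)) p[x])

∉⇒lookup≡false : ∀ {n} {x : Fin n} {p} → x ∉ p → lookup p x ≡ false
∉⇒lookup≡false {x = x} {p} x∉p with lookup p x in p[x]
... | true  = ⊥-elim (x∉p (lookup⇒[]= x p p[x]))
... | false = refl

⊆⇒white : ∀ {n} {S T : Subset n} → T ⊆ S → ∀ {x} → lookup S x ≡ false → lookup T x ≡ false
⊆⇒white T⊆S S[x] = ∉⇒lookup≡false (λ x∈T → lookup≡false⇒∉ S[x] (T⊆S x∈T))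

∣p∣≡0⇒p≡∅ : ∀ {n} (p : Subset n) → ∣ p ∣ ≡ 0 → p ≡ ∅
∣p∣≡0⇒p≡∅ []          _  = refl
∣p∣≡0⇒p≡∅ (false ∷ p) e = cong (false ∷_) (∣p∣≡0⇒p≡∅ p e)

∣p∣≡1⇒p≡⁅x⁆ : ∀ {n} (p : Subset n) → ∣ p ∣ ≡ 1 → ∃[ x ] p ≡ ⁅ x ⁆
∣p∣≡1⇒p≡⁅x⁆ (true ∷ p)  e = zero , cong (true ∷_) (∣p∣≡0⇒p≡∅ p (cong pred e))
∣p∣≡1⇒p≡⁅x⁆ (false ∷ p) e with ∣p∣≡1⇒p≡⁅x⁆ p e
... | x , p≡⁅x⁆ = suc x , cong (false ∷_) p≡⁅x⁆

record DifferOnlyAt {n} (c : Fin n) (S T : Subset n) : Set where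
  constructor differOnlyAt
  field
    elsewhere : ∀ v → v ≢ c → lookup T v ≡ lookup S v
    at        : lookup T c ≡ not (lookup S c)

TARAdj⇒differOnlyAt : ∀ {n} (S T : Subset n) → TARAdj S T → ∃[ c ] DifferOnlyAt c S T
TARAdj⇒differOnlyAt S T ∣S△T∣≡1 with ∣p∣≡1⇒p≡⁅x⁆ (S △ T) ∣S△T∣≡1
... | c , S△T≡⁅c⁆ = c , differOnlyAt
        (λ v v≢c → xor≡false⇒≡ (lookup S v) (lookup T v) (trans (S△T v) (≢⇒≡ᵇfalse v≢c)))
        (xor≡true⇒≡not (lookup S c) (lookup T c) (trans (S△T c) (≡ᵇ-refl c)))
  where
  S△T : ∀ v → (lookup S v xor lookup T v) ≡ (v ≡ᵇ c)
  S△T v = trans (sym (lookup-symDiff S T v)) (trans (cong (λ p → lookup p v) S△T≡⁅c⁆) (lookup-⁅⁆ c v))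

differOnlyAt⇒TARAdj : ∀ {n} {c : Fin n} {S T} → DifferOnlyAt c S T → TARAdj S T
differOnlyAt⇒TARAdj {c = c} {S} {T} (differOnlyAt elsewhere at) =
  subst (λ p → ∣ p ∣ ≡ 1) (sym (subset-ext {p = S △ T} {⁅ c ⁆} S△T≡⁅c⁆)) (∣⁅x⁆∣≡1 c)
  where
  S△T≡⁅c⁆ : ∀ v → lookup (S △ T) v ≡ lookup ⁅ c ⁆ v
  S△T≡⁅c⁆ v with v ≟ c
  ... | yes refl = trans (lookup-symDiff S T v) (trans (≡not⇒xor≡true _ _ at) (sym (trans (lookup-⁅⁆ v v) (≡ᵇ-refl v))))
  ... | no v≢c   = trans (lookup-symDiff S T v)
                     (trans (≡⇒xor≡false _ _ (elsewhere v v≢c)) (sym (trans (lookup-⁅⁆ c v) (≢⇒≡ᵇfalse v≢c))))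

differOnlyAt-sym : ∀ {n} {c : Fin n} {S T} → DifferOnlyAt c S T → DifferOnlyAt c T S
differOnlyAt-sym (differOnlyAt elsewhere at) =
  differOnlyAt (λ v v≢c → sym (elsewhere v v≢c)) (trans (sym (not-involutive _)) (cong not (sym at)))

differOnlyAt-unique : ∀ {n} {c : Fin n} {S T T'} → DifferOnlyAt c S T → DifferOnlyAt c S T' → T ≡ T'
differOnlyAt-unique {c = c} {T = T} {T'} (differOnlyAt elsewhere at) (differOnlyAt elsewhere' at') =
  subset-ext pointwise
  where
  pointwise : ∀ v → lookup T v ≡ lookup T' v
  pointwise v with v ≟ c
  ... | yes refl = trans at (sym at')
  ... | no v≢c   = trans (elsewhere v v≢c) (sym (elsewhere' v v≢c))

differOnlyAt-∪⁅⁆ : ∀ {n} {c : Fin n} {B} → lookup B c ≡ false → DifferOnlyAt c B (B ∪ ⁅ c ⁆)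
differOnlyAt-∪⁅⁆ {c = c} {B} c∉B = differOnlyAt
  (λ v v≢c → trans (lookup-∪ B ⁅ c ⁆ v)
    (trans (cong (lookup B v ∨_) (trans (lookup-⁅⁆ c v) (≢⇒≡ᵇfalse v≢c))) (∨-identityʳ _)))
  (trans (lookup-∪ B ⁅ c ⁆ c)
    (trans (cong (lookup B c ∨_) (trans (lookup-⁅⁆ c c) (≡ᵇ-refl c))) (trans (∨-zeroʳ _) (cong not (sym c∉B)))))

TARAdj-sym : ∀ {n} (S T : Subset n) → TARAdj S T → TARAdj T S
TARAdj-sym S T adj with TARAdj⇒differOnlyAt S T adj
... | _ , d = differOnlyAt⇒TARAdj (differOnlyAt-sym d)

allBut : ∀ {n} → Fin n → Subset n
allBut a = ∁ ⁅ a ⁆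

allBut₂ : ∀ {n} → Fin n → Fin n → Subset n
allBut₂ a b = ∁ (⁅ a ⁆ ∪ ⁅ b ⁆)

allBut₃ : ∀ {n} → Fin n → Fin n → Fin n → Subset n
allBut₃ c a b = ∁ (⁅ c ⁆ ∪ (⁅ a ⁆ ∪ ⁅ b ⁆))

lookup-∁[⁅a⁆∪p] : ∀ {n} (a : Fin n) p v → lookup (∁ (⁅ a ⁆ ∪ p)) v ≡ not ((v ≡ᵇ a) ∨ lookup p v)
lookup-∁[⁅a⁆∪p] a p v =
  trans (lookup-∁ (⁅ a ⁆ ∪ p) v) (cong not (trans (lookup-∪ ⁅ a ⁆ p v) (cong (_∨ lookup p v) (lookup-⁅⁆ a v))))

lookup-allBut : ∀ {n} (a v : Fin n) → lookup (allBut a) v ≡ not (v ≡ᵇ a)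
lookup-allBut a v = trans (lookup-∁ ⁅ a ⁆ v) (cong not (lookup-⁅⁆ a v))

lookup-allBut₂ : ∀ {n} (a b v : Fin n) → lookup (allBut₂ a b) v ≡ not ((v ≡ᵇ a) ∨ (v ≡ᵇ b))
lookup-allBut₂ a b v = trans (lookup-∁[⁅a⁆∪p] a ⁅ b ⁆ v) (cong (λ x → not ((v ≡ᵇ a) ∨ x)) (lookup-⁅⁆ b v))

allBut₂-comm : ∀ {n} (a b : Fin n) → allBut₂ a b ≡ allBut₂ b a
allBut₂-comm a b = cong ∁ (∪-comm ⁅ a ⁆ ⁅ b ⁆)

allBut₃-swap : ∀ {n} (c a b : Fin n) → allBut₃ c a b ≡ allBut₃ a c b
allBut₃-swap c a b = cong ∁ (trans (sym (∪-assoc ⁅ c ⁆ ⁅ a ⁆ ⁅ b ⁆))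
  (trans (cong (_∪ ⁅ b ⁆) (∪-comm ⁅ c ⁆ ⁅ a ⁆)) (∪-assoc ⁅ a ⁆ ⁅ c ⁆ ⁅ b ⁆)))

allBut₂⊆allBut : ∀ {n} (a b : Fin n) → allBut₂ a b ⊆ allBut a
allBut₂⊆allBut a b = p⊆q⇒∁p⊇∁q (p⊆p∪q ⁅ b ⁆)

allBut-omits : ∀ {n} (a : Fin n) → lookup (allBut a) a ≡ false
allBut-omits a = trans (lookup-allBut a a) (cong not (≡ᵇ-refl a))

allBut-keeps : ∀ {n} {a v : Fin n} → v ≢ a → lookup (allBut a) v ≡ true
allBut-keeps {a = a} {v} v≢a = trans (lookup-allBut a v) (cong not (≢⇒≡ᵇfalse v≢a))

∁[⁅a⁆∪p]-omits : ∀ {n} (a : Fin n) p → lookup (∁ (⁅ a ⁆ ∪ p)) a ≡ false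
∁[⁅a⁆∪p]-omits a p = trans (lookup-∁[⁅a⁆∪p] a p a) (cong (λ x → not (x ∨ lookup p a)) (≡ᵇ-refl a))

allBut₂-omitsˡ : ∀ {n} (a b : Fin n) → lookup (allBut₂ a b) a ≡ false
allBut₂-omitsˡ a b = ∁[⁅a⁆∪p]-omits a ⁅ b ⁆

allBut₂-omitsʳ : ∀ {n} (a b : Fin n) → lookup (allBut₂ a b) b ≡ false
allBut₂-omitsʳ a b = subst (λ S → lookup S b ≡ false) (allBut₂-comm b a) (allBut₂-omitsˡ b a)

allBut₂-keeps : ∀ {n} {a b v : Fin n} → v ≢ a → v ≢ b → lookup (allBut₂ a b) v ≡ true
allBut₂-keeps {a = a} {b} {v} v≢a v≢b =
  trans (lookup-allBut₂ a b v) (cong not (cong₂ _∨_ (≢⇒≡ᵇfalse v≢a) (≢⇒≡ᵇfalse v≢b)))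

allBut₃-omits₁ : ∀ {n} (c a b : Fin n) → lookup (allBut₃ c a b) c ≡ false
allBut₃-omits₁ c a b = ∁[⁅a⁆∪p]-omits c (⁅ a ⁆ ∪ ⁅ b ⁆)

allBut₃-omits₂ : ∀ {n} (c a b : Fin n) → lookup (allBut₃ c a b) a ≡ false
allBut₃-omits₂ c a b = subst (λ S → lookup S a ≡ false) (allBut₃-swap a c b) (allBut₃-omits₁ a c b)

allBut₃-omits₃ : ∀ {n} (c a b : Fin n) → lookup (allBut₃ c a b) b ≡ false
allBut₃-omits₃ c a b =
  subst (λ S → lookup S b ≡ false) (cong (λ p → ∁ (⁅ c ⁆ ∪ p)) (∪-comm ⁅ b ⁆ ⁅ a ⁆)) (allBut₃-omits₂ c b a)

allBut-white : ∀ {n} {a v : Fin n} → lookup (allBut a) v ≡ false → v ≡ a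
allBut-white {a = a} {v} white with v ≟ a
... | yes v≡a = v≡a
... | no v≢a  = ⊥-elim (true≢false (trans (sym (allBut-keeps v≢a)) white))

allBut₂-white : ∀ {n} {a b v : Fin n} → lookup (allBut₂ a b) v ≡ false → v ≡ a ⊎ v ≡ b
allBut₂-white {a = a} {b} {v} white with v ≟ a | v ≟ b
... | yes v≡a | _       = inj₁ v≡a
... | no _    | yes v≡b = inj₂ v≡b
... | no v≢a  | no v≢b  = ⊥-elim (true≢false (trans (sym (allBut₂-keeps v≢a v≢b)) white))

allBut₃-white : ∀ {n} {c a b v : Fin n} → lookup (allBut₃ c a b) v ≡ false → v ≡ c ⊎ v ≡ a ⊎ v ≡ b
allBut₃-white {c = c} {a} {b} {v} white with v ≟ c
... | yes v≡c = inj₁ v≡c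
... | no v≢c  = inj₂ (allBut₂-white (begin
  lookup (allBut₂ a b) v                     ≡⟨ lookup-∁ (⁅ a ⁆ ∪ ⁅ b ⁆) v ⟩
  not (lookup (⁅ a ⁆ ∪ ⁅ b ⁆) v)              ≡⟨ cong (λ x → not (x ∨ lookup (⁅ a ⁆ ∪ ⁅ b ⁆) v)) (≢⇒≡ᵇfalse v≢c) ⟨
  not ((v ≡ᵇ c) ∨ lookup (⁅ a ⁆ ∪ ⁅ b ⁆) v)    ≡⟨ lookup-∁[⁅a⁆∪p] c (⁅ a ⁆ ∪ ⁅ b ⁆) v ⟨
  lookup (allBut₃ c a b) v                   ≡⟨ white ⟩
  false                                      ∎))
  where open ≡-Reasoning

≢-at : ∀ {n} {S T : Subset n} v → lookup S v ≡ true → lookup T v ≡ false → S ≢ T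
≢-at v S[v] T[v] S≡T = true≢false (trans (sym S[v]) (trans (cong (λ X → lookup X v) S≡T) T[v]))

allBut-injective : ∀ {n} {a b : Fin n} → allBut a ≡ allBut b → a ≡ b
allBut-injective {a = a} e = allBut-white (trans (cong (λ S → lookup S a) (sym e)) (allBut-omits a))

allBut≢⊤ : ∀ {n} (a : Fin n) → allBut a ≢ ⊤
allBut≢⊤ a = ≢-sym (≢-at a (lookup-⊤ a) (allBut-omits a))

allBut₂≢⊤ : ∀ {n} (a b : Fin n) → allBut₂ a b ≢ ⊤
allBut₂≢⊤ a b = ≢-sym (≢-at a (lookup-⊤ a) (allBut₂-omitsˡ a b))

allBut₂≢allBut : ∀ {n} {a b : Fin n} → a ≢ b → ∀ c → allBut₂ a b ≢ allBut c
allBut₂≢allBut {a = a} {b} a≢b c e with c ≟ a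
... | yes refl = ≢-at b (allBut-keeps (≢-sym a≢b)) (allBut₂-omitsʳ a b) (sym e)
... | no c≢a   = ≢-at a (allBut-keeps (≢-sym c≢a)) (allBut₂-omitsˡ a b) (sym e)

allBut₂-injectiveˡ : ∀ {n} {c c' a : Fin n} → allBut₂ c a ≡ allBut₂ c' a → c ≡ c'
allBut₂-injectiveˡ {c = c} {c'} e with allBut₂-white (trans (cong (λ S → lookup S c) (sym e)) (allBut₂-omitsˡ c _))
... | inj₁ c≡c' = c≡c'
... | inj₂ refl with allBut₂-white (trans (cong (λ S → lookup S c') e) (allBut₂-omitsˡ c' _))
...   | inj₁ c'≡c = sym c'≡c
...   | inj₂ c'≡c = sym c'≡c

∁[⁅c⁆∪p]∪⁅c⁆ : ∀ {n} (c : Fin n) p → lookup p c ≡ false → ∁ (⁅ c ⁆ ∪ p) ∪ ⁅ c ⁆ ≡ ∁ p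
∁[⁅c⁆∪p]∪⁅c⁆ c p p[c] = subset-ext {p = ∁ (⁅ c ⁆ ∪ p) ∪ ⁅ c ⁆} {∁ p} pointwise
  where
  pointwise : ∀ v → lookup (∁ (⁅ c ⁆ ∪ p) ∪ ⁅ c ⁆) v ≡ lookup (∁ p) v
  pointwise v rewrite lookup-∪ (∁ (⁅ c ⁆ ∪ p)) ⁅ c ⁆ v | lookup-∁[⁅a⁆∪p] c p v | lookup-⁅⁆ c v | lookup-∁ p v
    with v ≟ c
  ... | yes refl rewrite p[c] = refl
  ... | no _     = ∨-identityʳ _

allBut₂∪⁅⁆ : ∀ {n} {a b : Fin n} → a ≢ b → allBut₂ a b ∪ ⁅ a ⁆ ≡ allBut b
allBut₂∪⁅⁆ {a = a} {b} a≢b = ∁[⁅c⁆∪p]∪⁅c⁆ a ⁅ b ⁆ (trans (lookup-⁅⁆ b a) (≢⇒≡ᵇfalse a≢b))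

allBut₃∪⁅⁆ : ∀ {n} {c a b : Fin n} → c ≢ a → c ≢ b → allBut₃ c a b ∪ ⁅ c ⁆ ≡ allBut₂ a b
allBut₃∪⁅⁆ {c = c} {a} {b} c≢a c≢b = ∁[⁅c⁆∪p]∪⁅c⁆ c (⁅ a ⁆ ∪ ⁅ b ⁆)
  (trans (lookup-∪ ⁅ a ⁆ ⁅ b ⁆ c)
    (cong₂ _∨_ (trans (lookup-⁅⁆ a c) (≢⇒≡ᵇfalse c≢a)) (trans (lookup-⁅⁆ b c) (≢⇒≡ᵇfalse c≢b))))

allBut∪⁅⁆ : ∀ {n} (a : Fin n) → allBut a ∪ ⁅ a ⁆ ≡ ⊤
allBut∪⁅⁆ a = trans (∪-comm (allBut a) ⁅ a ⁆) (p∪∁p≡⊤ ⁅ a ⁆)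

differOnlyAt-insert : ∀ {n} {c : Fin n} {B B'} → lookup B c ≡ false → B ∪ ⁅ c ⁆ ≡ B' → DifferOnlyAt c B B'
differOnlyAt-insert B[c] refl = differOnlyAt-∪⁅⁆ B[c]

allBut-differOnlyAt-⊤ : ∀ {n} (a : Fin n) → DifferOnlyAt a (allBut a) ⊤
allBut-differOnlyAt-⊤ a = differOnlyAt-insert (allBut-omits a) (allBut∪⁅⁆ a)

allBut₂-differOnlyAt-allBut : ∀ {n} {a b : Fin n} → a ≢ b → DifferOnlyAt a (allBut₂ a b) (allBut b)
allBut₂-differOnlyAt-allBut {a = a} {b} a≢b = differOnlyAt-insert (allBut₂-omitsˡ a b) (allBut₂∪⁅⁆ a≢b)

allBut₃-differOnlyAt-allBut₂ : ∀ {n} {c a b : Fin n} → c ≢ a → c ≢ b → DifferOnlyAt c (allBut₃ c a b) (allBut₂ a b)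
allBut₃-differOnlyAt-allBut₂ {c = c} {a} {b} c≢a c≢b = differOnlyAt-insert (allBut₃-omits₁ c a b) (allBut₃∪⁅⁆ c≢a c≢b)

TARAdj-allBut-⊤ : ∀ {n} (a : Fin n) → TARAdj (allBut a) ⊤
TARAdj-allBut-⊤ a = differOnlyAt⇒TARAdj (allBut-differOnlyAt-⊤ a)

TARAdj-allBut₂-allBut : ∀ {n} {a b : Fin n} → a ≢ b → TARAdj (allBut₂ a b) (allBut b)
TARAdj-allBut₂-allBut a≢b = differOnlyAt⇒TARAdj (allBut₂-differOnlyAt-allBut a≢b)

TARAdj-allBut₃-allBut₂ : ∀ {n} {c a b : Fin n} → c ≢ a → c ≢ b → TARAdj (allBut₃ c a b) (allBut₂ a b)
TARAdj-allBut₃-allBut₂ c≢a c≢b = differOnlyAt⇒TARAdj (allBut₃-differOnlyAt-allBut₂ c≢a c≢b)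

TARAdj-allBut-allBut₂ʳ : ∀ {n} {a b : Fin n} → a ≢ b → TARAdj (allBut b) (allBut₂ a b)
TARAdj-allBut-allBut₂ʳ {a = a} {b} a≢b = TARAdj-sym (allBut₂ a b) (allBut b) (TARAdj-allBut₂-allBut a≢b)

TARAdj-allBut-allBut₂ˡ : ∀ {n} {a b : Fin n} → a ≢ b → TARAdj (allBut a) (allBut₂ a b)
TARAdj-allBut-allBut₂ˡ {a = a} {b} a≢b = subst (TARAdj (allBut a)) (allBut₂-comm b a) (TARAdj-allBut-allBut₂ʳ (≢-sym a≢b))

TARAdj-⊤ : ∀ {n} T → TARAdj ⊤ T → ∃[ c ] T ≡ allBut {n} c
TARAdj-⊤ T adj with TARAdj⇒differOnlyAt ⊤ T adj
... | c , d = c , differOnlyAt-unique d (differOnlyAt-sym (allBut-differOnlyAt-⊤ c))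

TARAdj-allBut : ∀ {n} (a : Fin n) T → TARAdj (allBut a) T → T ≡ ⊤ ⊎ ∃[ c ] (c ≢ a × T ≡ allBut₂ c a)
TARAdj-allBut a T adj with TARAdj⇒differOnlyAt (allBut a) T adj
... | c , d with c ≟ a
...   | yes refl = inj₁ (differOnlyAt-unique d (allBut-differOnlyAt-⊤ c))
...   | no c≢a   = inj₂ (c , c≢a , differOnlyAt-unique d (differOnlyAt-sym (allBut₂-differOnlyAt-allBut c≢a)))

common-TARAdj-allBut : ∀ {n} {a b : Fin n} → a ≢ b → ∀ T → TARAdj (allBut a) T → TARAdj (allBut b) T →
  T ≡ ⊤ ⊎ T ≡ allBut₂ b a
common-TARAdj-allBut {a = a} {b} a≢b T adj-a adj-b with TARAdj-allBut a T adj-a | TARAdj-allBut b T adj-b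
... | inj₁ T≡⊤           | _                  = inj₁ T≡⊤
... | inj₂ _             | inj₁ T≡⊤           = inj₁ T≡⊤
... | inj₂ (c , _ , T≡c) | inj₂ (d , _ , T≡d)
  with allBut₂-white {a = c} {a} (trans (cong (λ S → lookup S b) (trans (sym T≡c) T≡d)) (allBut₂-omitsʳ d b))
...   | inj₁ b≡c = inj₂ (trans T≡c (cong (λ c → allBut₂ c a) (sym b≡c)))
...   | inj₂ b≡a = ⊥-elim (a≢b (sym b≡a))

TARAdj-allBut₂ : ∀ {n} {a b : Fin n} → a ≢ b → ∀ T → TARAdj (allBut₂ a b) T →
  T ≡ allBut a ⊎ T ≡ allBut b ⊎ ∃[ c ] (c ≢ a × c ≢ b × T ≡ allBut₃ c a b)
TARAdj-allBut₂ {a = a} {b} a≢b T adj with TARAdj⇒differOnlyAt (allBut₂ a b) T adj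
... | c , d with c ≟ a | c ≟ b
...   | yes refl | _        = inj₂ (inj₁ (differOnlyAt-unique d (allBut₂-differOnlyAt-allBut a≢b)))
...   | no _     | yes refl =
  inj₁ (differOnlyAt-unique d
    (subst (λ S → DifferOnlyAt c S (allBut a)) (allBut₂-comm c a) (allBut₂-differOnlyAt-allBut (≢-sym a≢b))))
...   | no c≢a   | no c≢b   =
  inj₂ (inj₂ (c , c≢a , c≢b , differOnlyAt-unique d (differOnlyAt-sym (allBut₃-differOnlyAt-allBut₂ c≢a c≢b))))

module SkewForcingIn {n} (K : Graph n) where

  adj⇒≢ : ∀ {u v} → adj K u v ≡ true → u ≢ v
  adj⇒≢ {u} u~v refl = true≢false (trans (sym u~v) (Graph.irrefl K u))

  adj-sym : ∀ {u v} → adj K u v ≡ true → adj K v u ≡ true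
  adj-sym {u} {v} u~v = trans (Graph.sym K v u) u~v

  adj-true-false⇒≢ : ∀ {u v w} → adj K u v ≡ true → adj K u w ≡ false → v ≢ w
  adj-true-false⇒≢ {u} u~v u≁w v≡w = true≢false (trans (sym u~v) (trans (cong (adj K u) v≡w) u≁w))

  lookup-N : ∀ u v → lookup (N K u) v ≡ adj K u v
  lookup-N u v = lookup∘tabulate (adj K u) v

  record Force (B B' : Subset n) : Set where
    field
      forcer forced : Fin n
      forcer~forced : adj K forcer forced ≡ true
      forced-white  : lookup B forced ≡ false
      only-white    : ∀ v → adj K forcer v ≡ true → lookup B v ≡ false → v ≡ forced
      result        : B ∪ ⁅ forced ⁆ ≡ B'

    stays-white : ∀ {x} → lookup B x ≡ false → x ≢ forced → lookup B' x ≡ false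
    stays-white {x} B[x] x≢forced = trans (DifferOnlyAt.elsewhere (differOnlyAt-insert forced-white result) x x≢forced) B[x]

  skewStep : ∀ {B B'} → Force B B' → SkewStep K B B'
  skewStep f = forcer , forced
    , lookup⇒[]= forced (N K forcer) (trans (lookup-N forcer forced) forcer~forced)
    , lookup≡false⇒∉ forced-white
    , (λ v v∈N v∉B → only-white v (trans (sym (lookup-N forcer v)) ([]=⇒lookup v∈N)) (∉⇒lookup≡false v∉B))
    , sym result
    where open Force f

  force : ∀ {B B'} → SkewStep K B B' → Force B B'
  force (u , w , w∈N , w∉B , only , refl) = record
    { forcer        = u
    ; forced        = w
    ; forcer~forced = trans (sym (lookup-N u w)) ([]=⇒lookup w∈N)
    ; forced-white  = ∉⇒lookup≡false w∉B
    ; only-white    = λ v u~v B[v] → only v (lookup⇒[]= v (N K u) (trans (lookup-N u v) u~v)) (lookup≡false⇒∉ B[v])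
    ; result        = refl
    }

  Unforceable : (Fin n → Set) → Set
  Unforceable W = ∀ {B B'} (f : Force B B') → (∀ w → W w → lookup B w ≡ false) → ¬ W (Force.forced f)

  unforceable⇒¬forcing : ∀ {W S} → Unforceable W → ∀ w → W w → (∀ v → W v → lookup S v ≡ false) → ¬ SkewForcing K S
  unforceable⇒¬forcing unforceable w Ww white ε       = true≢false (trans (sym (lookup-⊤ w)) (white w Ww))
  unforceable⇒¬forcing {W} {S} unforceable w Ww white (_◅_ {j = B'} step steps) =
    unforceable⇒¬forcing unforceable w Ww still-white steps
    where
    f : Force S B'
    f = force step
    still-white : ∀ v → W v → lookup B' v ≡ false
    still-white v Wv = Force.stays-white f (white v Wv) (λ v≡forced → unforceable f white (subst W v≡forced Wv))

  allBut-forcing : NoIsolatedVertices K → ∀ a → SkewForcing K (allBut a)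
  allBut-forcing noIsolated a with noIsolated a
  ... | u , a~u = skewStep f ◅ ε
    where
    f : Force (allBut a) ⊤
    f = record { forcer = u ; forced = a ; forcer~forced = adj-sym a~u ; forced-white = allBut-omits a
               ; only-white = λ v _ white → allBut-white white ; result = allBut∪⁅⁆ a }

  allBut₂-forcing : NoIsolatedVertices K → ∀ {a b u} → a ≢ b → adj K u a ≡ true → adj K u b ≡ false →
    SkewForcing K (allBut₂ a b)
  allBut₂-forcing noIsolated {a} {b} {u} a≢b u~a u≁b = skewStep f ◅ allBut-forcing noIsolated b
    where
    f : Force (allBut₂ a b) (allBut b)
    f = record { forcer = u ; forced = a ; forcer~forced = u~a ; forced-white = allBut₂-omitsˡ a b
               ; only-white = λ v u~v white →
                   [ (λ v≡a → v≡a) , (λ v≡b → ⊥-elim (adj-true-false⇒≢ u~v u≁b v≡b)) ] (allBut₂-white white)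
               ; result = allBut₂∪⁅⁆ a≢b }

  allBut₃-forcing : ∀ {c a b u} → c ≢ a → c ≢ b → adj K u c ≡ true → adj K u a ≡ false → adj K u b ≡ false →
    SkewForcing K (allBut₂ a b) → SkewForcing K (allBut₃ c a b)
  allBut₃-forcing {c} {a} {b} {u} c≢a c≢b u~c u≁a u≁b forcing = skewStep f ◅ forcing
    where
    only-white : ∀ v → adj K u v ≡ true → lookup (allBut₃ c a b) v ≡ false → v ≡ c
    only-white v u~v white with allBut₃-white white
    ... | inj₁ v≡c        = v≡c
    ... | inj₂ (inj₁ v≡a) = ⊥-elim (adj-true-false⇒≢ u~v u≁a v≡a)
    ... | inj₂ (inj₂ v≡b) = ⊥-elim (adj-true-false⇒≢ u~v u≁b v≡b)
    f : Force (allBut₃ c a b) (allBut₂ a b)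
    f = record { forcer = u ; forced = c ; forcer~forced = u~c ; forced-white = allBut₃-omits₁ c a b
               ; only-white = only-white ; result = allBut₃∪⁅⁆ c≢a c≢b }

-- A graph is complete multipartite iff non-adjacency is transitive, i.e. iff non-adjacent vertices are twins;
-- this is the only way the hypothesis on G enters.
NonAdjacentAreTwins : ∀ {n} → Graph n → Set
NonAdjacentAreTwins K = ∀ x y → adj K x y ≡ false → ∀ u → adj K u x ≡ adj K u y

module TwinGraph {n} (K : Graph n) (twins : NonAdjacentAreTwins K) where
  open SkewForcingIn K

  twin-pair-unforceable : ∀ {a b} → a ≢ b → adj K a b ≡ false → Unforceable (λ v → v ≡ a ⊎ v ≡ b)
  twin-pair-unforceable {a} {b} a≢b a≁b f white (inj₁ refl) =
    a≢b (sym (Force.only-white f b (trans (sym (twins a b a≁b _)) (Force.forcer~forced f)) (white b (inj₂ refl))))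
  twin-pair-unforceable {a} {b} a≢b a≁b f white (inj₂ refl) =
    a≢b (Force.only-white f a (trans (twins a b a≁b _) (Force.forcer~forced f)) (white a (inj₁ refl)))

  -- The forcer is adjacent to neither white endpoint, hence a twin of both, so the endpoints would be non-adjacent.
  white-edge-hit : ∀ {B B'} (f : Force B B') {p q} → lookup B p ≡ false → lookup B q ≡ false → adj K p q ≡ true →
    p ≡ Force.forced f ⊎ q ≡ Force.forced f
  white-edge-hit f {p} {q} B[p] B[q] p~q with p ≟ Force.forced f | q ≟ Force.forced f
  ... | yes p≡forced | _            = inj₁ p≡forced
  ... | no _         | yes q≡forced = inj₂ q≡forced
  ... | no p≢forced  | no q≢forced  = ⊥-elim (true≢false (begin
    true             ≡⟨ adj-sym p~q ⟨
    adj K q p        ≡⟨ twins forcer p (¬-not (λ u~p → p≢forced (only-white p u~p B[p]))) q ⟨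
    adj K q forcer   ≡⟨ twins forcer q (¬-not (λ u~q → q≢forced (only-white q u~q B[q]))) q ⟩
    adj K q q        ≡⟨ Graph.irrefl K q ⟩
    false            ∎))
    where
    open Force f
    open ≡-Reasoning

  white-triangle-unforceable : ∀ {a b c} → a ≢ b → a ≢ c → b ≢ c →
    adj K a b ≡ true → adj K a c ≡ true → adj K b c ≡ true → Unforceable (λ v → v ≡ a ⊎ v ≡ b ⊎ v ≡ c)
  white-triangle-unforceable {a} {b} {c} a≢b a≢c b≢c a~b a~c b~c f white (inj₁ refl) =
    [ (λ b≡a → a≢b (sym b≡a)) , (λ c≡a → a≢c (sym c≡a)) ]
      (white-edge-hit f (white b (inj₂ (inj₁ refl))) (white c (inj₂ (inj₂ refl))) b~c)
  white-triangle-unforceable {a} {b} {c} a≢b a≢c b≢c a~b a~c b~c f white (inj₂ (inj₁ refl)) =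
    [ (λ a≡b → a≢b a≡b) , (λ c≡b → b≢c (sym c≡b)) ]
      (white-edge-hit f (white a (inj₁ refl)) (white c (inj₂ (inj₂ refl))) a~c)
  white-triangle-unforceable {a} {b} {c} a≢b a≢c b≢c a~b a~c b~c f white (inj₂ (inj₂ refl)) =
    [ (λ a≡c → a≢c a≡c) , (λ b≡c → b≢c b≡c) ] (white-edge-hit f (white a (inj₁ refl)) (white b (inj₂ (inj₁ refl))) a~b)

  white-twins⇒¬forcing : ∀ {S a b} → a ≢ b → adj K a b ≡ false →
    lookup S a ≡ false → lookup S b ≡ false → ¬ SkewForcing K S
  white-twins⇒¬forcing {S} {a} {b} a≢b a≁b S[a] S[b] = unforceable⇒¬forcing (twin-pair-unforceable a≢b a≁b) a (inj₁ refl) white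
    where
    white : ∀ v → v ≡ a ⊎ v ≡ b → lookup S v ≡ false
    white _ (inj₁ refl) = S[a]
    white _ (inj₂ refl) = S[b]

  three-white⇒¬forcing : ∀ {S a b c} → a ≢ b → a ≢ c → b ≢ c →
    lookup S a ≡ false → lookup S b ≡ false → lookup S c ≡ false → ¬ SkewForcing K S
  three-white⇒¬forcing {S} {a} {b} {c} a≢b a≢c b≢c S[a] S[b] S[c] with adj K a b in a~b | adj K a c in a~c | adj K b c in b~c
  ... | false | _     | _     = white-twins⇒¬forcing a≢b a~b S[a] S[b]
  ... | true  | false | _     = white-twins⇒¬forcing a≢c a~c S[a] S[c]
  ... | true  | true  | false = white-twins⇒¬forcing b≢c b~c S[b] S[c]
  ... | true  | true  | true  =
    unforceable⇒¬forcing (white-triangle-unforceable a≢b a≢c b≢c a~b a~c b~c) a (inj₁ refl) white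
    where
    white : ∀ v → v ≡ a ⊎ v ≡ b ⊎ v ≡ c → lookup S v ≡ false
    white _ (inj₁ refl)        = S[a]
    white _ (inj₂ (inj₁ refl)) = S[b]
    white _ (inj₂ (inj₂ refl)) = S[c]

  allBut₂-forcing⇒adj : ∀ {a b} → a ≢ b → SkewForcing K (allBut₂ a b) → adj K a b ≡ true
  allBut₂-forcing⇒adj {a} {b} a≢b forcing with adj K a b in a~b
  ... | true  = refl
  ... | false = ⊥-elim (white-twins⇒¬forcing a≢b a~b (allBut₂-omitsˡ a b) (allBut₂-omitsʳ a b) forcing)

  data ForcingShape (S : Subset n) : Set where
    is⊤       : S ≡ ⊤ → ForcingShape S
    isAllBut  : ∀ a → S ≡ allBut a → ForcingShape S
    isAllBut₂ : ∀ {a b} → a ≢ b → adj K a b ≡ true → S ≡ allBut₂ a b → ForcingShape S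

  forcingShape : ∀ S → SkewForcing K S → ForcingShape S
  forcingShape S forcing with any? (λ v → lookup S v Bool.≟ false)
  ... | no ¬white =
    is⊤ (white-ext (λ v S[v] → ⊥-elim (¬white (v , S[v]))) (λ v ⊤[v] → ⊥-elim (true≢false (trans (sym (lookup-⊤ v)) ⊤[v]))))
  ... | yes (a , S[a]) with any? (λ v → (lookup S v Bool.≟ false) ×-dec ¬? (v ≟ a))
  ...   | no ¬white = isAllBut a (white-ext S⇒allBut (λ v white → subst (λ x → lookup S x ≡ false) (sym (allBut-white white)) S[a]))
    where
    S⇒allBut : ∀ v → lookup S v ≡ false → lookup (allBut a) v ≡ false
    S⇒allBut v S[v] with v ≟ a
    ... | yes refl = allBut-omits a
    ... | no v≢a   = ⊥-elim (¬white (v , S[v] , v≢a))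
  ...   | yes (b , S[b] , b≢a) with any? (λ v → (lookup S v Bool.≟ false) ×-dec (¬? (v ≟ a) ×-dec ¬? (v ≟ b)))
  ...     | yes (c , S[c] , c≢a , c≢b) =
    ⊥-elim (three-white⇒¬forcing (≢-sym b≢a) (≢-sym c≢a) (≢-sym c≢b) S[a] S[b] S[c] forcing)
  ...     | no ¬white =
    isAllBut₂ (≢-sym b≢a) (allBut₂-forcing⇒adj (≢-sym b≢a) (subst (SkewForcing K) S≡allBut₂ forcing)) S≡allBut₂
    where
    S⇒allBut₂ : ∀ v → lookup S v ≡ false → lookup (allBut₂ a b) v ≡ false
    S⇒allBut₂ v S[v] with v ≟ a | v ≟ b
    ... | yes refl | _        = allBut₂-omitsˡ a b
    ... | no _     | yes refl = allBut₂-omitsʳ a b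
    ... | no v≢a   | no v≢b   = ⊥-elim (¬white (v , S[v] , v≢a , v≢b))
    allBut₂⇒S : ∀ v → lookup (allBut₂ a b) v ≡ false → lookup S v ≡ false
    allBut₂⇒S v white with allBut₂-white {a = a} {b} white
    ... | inj₁ refl = S[a]
    ... | inj₂ refl = S[b]
    S≡allBut₂ : S ≡ allBut₂ a b
    S≡allBut₂ = white-ext S⇒allBut₂ allBut₂⇒S

  allBut₂-forcing-TARAdj : ∀ {a b} → a ≢ b → ∀ T → SkewForcing K T → TARAdj (allBut₂ a b) T →
    T ≡ allBut a ⊎ T ≡ allBut b
  allBut₂-forcing-TARAdj a≢b T forcing adj with TARAdj-allBut₂ a≢b T adj
  ... | inj₁ T≡allBut-a = inj₁ T≡allBut-a
  ... | inj₂ (inj₁ T≡allBut-b) = inj₂ T≡allBut-b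
  ... | inj₂ (inj₂ (c , c≢a , c≢b , refl)) =
    ⊥-elim (three-white⇒¬forcing c≢a c≢b a≢b (allBut₃-omits₁ c _ _) (allBut₃-omits₂ c _ _) (allBut₃-omits₃ c _ _) forcing)

elements : ∀ {n} → Subset n → List (Fin n)
elements []          = []
elements (true ∷ p)  = zero ∷ List.map suc (elements p)
elements (false ∷ p) = List.map suc (elements p)

length-elements : ∀ {n} (p : Subset n) → length (elements p) ≡ ∣ p ∣
length-elements []          = refl
length-elements (true ∷ p)  = cong suc (trans (length-map suc (elements p)) (length-elements p))
length-elements (false ∷ p) = trans (length-map suc (elements p)) (length-elements p)

∈-elements⁻ : ∀ {n} (p : Subset n) {x} → x ∈ₗ elements p → lookup p x ≡ true
∈-elements⁻ (true ∷ p)  {zero}  _         = refl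
∈-elements⁻ (true ∷ p)  {suc x} (there m) with ∈-map⁻ suc m
... | y , y∈ , refl = ∈-elements⁻ p y∈
∈-elements⁻ (false ∷ p) {x}     m         with ∈-map⁻ suc m
... | y , y∈ , refl = ∈-elements⁻ p y∈

∈-elements⁺ : ∀ {n} (p : Subset n) {x} → lookup p x ≡ true → x ∈ₗ elements p
∈-elements⁺ (true ∷ p)  {zero}  _    = here refl
∈-elements⁺ (true ∷ p)  {suc x} p[x] = there (∈-map⁺ suc (∈-elements⁺ p p[x]))
∈-elements⁺ (false ∷ p) {suc x} p[x] = ∈-map⁺ suc (∈-elements⁺ p p[x])

elements-unique : ∀ {n} (p : Subset n) → Unique (elements p)
elements-unique []          = []
elements-unique (true ∷ p)  = All.map⁺ (All.tabulate (λ _ ())) ∷ Unique.map⁺ Fin.suc-injective (elements-unique p)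
elements-unique (false ∷ p) = Unique.map⁺ Fin.suc-injective (elements-unique p)

1≤∣p∣⇒nonempty : ∀ {n} (p : Subset n) → 1 ≤ ∣ p ∣ → ∃[ x ] lookup p x ≡ true
1≤∣p∣⇒nonempty (true ∷ p)  _ = zero , refl
1≤∣p∣⇒nonempty (false ∷ p) h with 1≤∣p∣⇒nonempty p h
... | x , p[x] = suc x , p[x]

∣⁅x⁆∪⁅y⁆∣≡2 : ∀ {n} {x y : Fin n} → x ≢ y → ∣ ⁅ x ⁆ ∪ ⁅ y ⁆ ∣ ≡ 2
∣⁅x⁆∪⁅y⁆∣≡2 {x = zero}  {zero}  x≢y = ⊥-elim (x≢y refl)
∣⁅x⁆∪⁅y⁆∣≡2 {x = zero}  {suc y} _   = cong suc (trans (cong ∣_∣ (∪-identityˡ ⁅ y ⁆)) (∣⁅x⁆∣≡1 y))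
∣⁅x⁆∪⁅y⁆∣≡2 {x = suc x} {zero}  _   = cong suc (trans (cong ∣_∣ (∪-identityʳ ⁅ x ⁆)) (∣⁅x⁆∣≡1 x))
∣⁅x⁆∪⁅y⁆∣≡2 {x = suc x} {suc y} x≢y = ∣⁅x⁆∪⁅y⁆∣≡2 (λ x≡y → x≢y (cong suc x≡y))

∣allBut∣ : ∀ {n} (a : Fin n) → ∣ allBut a ∣ ≡ n ∸ 1
∣allBut∣ {n} a = trans (∣∁p∣≡n∸∣p∣ ⁅ a ⁆) (cong (n ∸_) (∣⁅x⁆∣≡1 a))

∣allBut₂∣ : ∀ {n} {a b : Fin n} → a ≢ b → ∣ allBut₂ a b ∣ ≡ n ∸ 2
∣allBut₂∣ {n} {a} {b} a≢b = trans (∣∁p∣≡n∸∣p∣ (⁅ a ⁆ ∪ ⁅ b ⁆)) (cong (n ∸_) (∣⁅x⁆∪⁅y⁆∣≡2 a≢b))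

∣p∣≡n∸1⇒p≡allBut : ∀ {n} (p : Subset n) → 1 ≤ n → ∣ p ∣ ≡ n ∸ 1 → ∃[ a ] p ≡ allBut a
∣p∣≡n∸1⇒p≡allBut {n} p 1≤n ∣p∣≡n∸1
  with ∣p∣≡1⇒p≡⁅x⁆ (∁ p) (trans (∣∁p∣≡n∸∣p∣ p) (trans (cong (n ∸_) ∣p∣≡n∸1) (m∸[m∸n]≡n 1≤n)))
... | a , ∁p≡⁅a⁆ = a , subset-ext {p = p} {allBut a} λ v → begin
  lookup p v               ≡⟨ not-involutive _ ⟨
  not (not (lookup p v))   ≡⟨ cong not (lookup-∁ p v) ⟨
  not (lookup (∁ p) v)     ≡⟨ cong (λ q → not (lookup q v)) ∁p≡⁅a⁆ ⟩
  not (lookup ⁅ a ⁆ v)     ≡⟨ lookup-∁ ⁅ a ⁆ v ⟨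
  lookup (allBut a) v      ∎
  where open ≡-Reasoning

distinct⇒2≤n : ∀ {n} {a b : Fin n} → a ≢ b → 2 ≤ n
distinct⇒2≤n {suc zero}    {zero} {zero} a≢b = ⊥-elim (a≢b refl)
distinct⇒2≤n {suc (suc n)} _                 = s≤s (s≤s z≤n)

another : ∀ {t} → 2 ≤ t → (i : Fin t) → ∃[ j ] j ≢ i
another (s≤s (s≤s _)) zero    = suc zero , λ ()
another (s≤s (s≤s _)) (suc i) = zero , λ ()

module CompleteMultipartite {t} (2≤t : 2 ≤ t) (ns : Fin t → ℕ) (1≤ns : ∀ i → 1 ≤ ns i)
    {n} (G : Graph n) (part : Fin n → Fin t) (G-multipartite : IsCompleteMultipartite G part ns) where
  open SkewForcingIn G

  adj⇒different-parts : ∀ {u v} → adj G u v ≡ true → part u ≢ part v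
  adj⇒different-parts {u} {v} = Equivalence.to (proj₁ G-multipartite u v)

  different-parts⇒adj : ∀ {u v} → part u ≢ part v → adj G u v ≡ true
  different-parts⇒adj {u} {v} = Equivalence.from (proj₁ G-multipartite u v)

  non-adj⇒same-part : ∀ {u v} → adj G u v ≡ false → part u ≡ part v
  non-adj⇒same-part {u} {v} u≁v with part u ≟ part v
  ... | yes same = same
  ... | no different = ⊥-elim (true≢false (trans (sym (different-parts⇒adj different)) u≁v))

  different-parts⇒≢ : ∀ {u v} → part u ≢ part v → u ≢ v
  different-parts⇒≢ pu≢pv u≡v = pu≢pv (cong part u≡v)

  twins : NonAdjacentAreTwins G
  twins x y x≁y u with adj G u x in u~x | adj G u y in u~y
  ... | true  | true  = refl
  ... | false | false = refl
  ... | true  | false = ⊥-elim (adj⇒different-parts u~x (trans (non-adj⇒same-part u~y) (sym (non-adj⇒same-part x≁y))))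
  ... | false | true  = ⊥-elim (adj⇒different-parts u~y (trans (non-adj⇒same-part u~x) (non-adj⇒same-part x≁y)))

  open TwinGraph G twins

  lookup-PartiteSet : ∀ i v → lookup (PartiteSet part i) v ≡ (part v ≡ᵇ i)
  lookup-PartiteSet i v = lookup∘tabulate (λ v → ⌊ part v ≟ i ⌋) v

  inhabitant : ∀ i → ∃[ v ] part v ≡ i
  inhabitant i with 1≤∣p∣⇒nonempty (PartiteSet part i) (subst (1 ≤_) (sym (proj₂ G-multipartite i)) (1≤ns i))
  ... | v , v∈Yᵢ = v , ≡ᵇtrue⇒≡ (trans (sym (lookup-PartiteSet i v)) v∈Yᵢ)

  noIsolated : NoIsolatedVertices G
  noIsolated u with another 2≤t (part u)
  ... | i , i≢pu with inhabitant i
  ...   | v , refl = v , different-parts⇒adj (≢-sym i≢pu)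

  vertex : Fin n
  vertex = proj₁ (inhabitant (first 2≤t))
    where
    first : ∀ {k} → 2 ≤ k → Fin k
    first (s≤s _) = zero

  2≤n : 2 ≤ n
  2≤n = distinct⇒2≤n (adj⇒≢ (proj₂ (noIsolated vertex)))

  omitsTwo⇒forcing : ∀ {u v} → part u ≢ part v → SkewForcing G (allBut₂ u v)
  omitsTwo⇒forcing {u} {v} pu≢pv =
    allBut₂-forcing noIsolated (different-parts⇒≢ pu≢pv) (different-parts⇒adj (≢-sym pu≢pv)) (Graph.irrefl G v)

  omitsTwo⇒minimal : ∀ {u v} → part u ≢ part v → ∀ T → T ⊆ allBut₂ u v → SkewForcing G T → T ≡ allBut₂ u v
  omitsTwo⇒minimal {u} {v} pu≢pv T T⊆ forcing = white-ext T⇒allBut₂ allBut₂⇒T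
    where
    T[u] : lookup T u ≡ false
    T[u] = ⊆⇒white T⊆ (allBut₂-omitsˡ u v)
    T[v] : lookup T v ≡ false
    T[v] = ⊆⇒white T⊆ (allBut₂-omitsʳ u v)
    T⇒allBut₂ : ∀ x → lookup T x ≡ false → lookup (allBut₂ u v) x ≡ false
    T⇒allBut₂ x T[x] with x ≟ u | x ≟ v
    ... | yes refl | _        = allBut₂-omitsˡ u v
    ... | no _     | yes refl = allBut₂-omitsʳ u v
    ... | no x≢u   | no x≢v   =
      ⊥-elim (three-white⇒¬forcing (different-parts⇒≢ pu≢pv) (≢-sym x≢u) (≢-sym x≢v) T[u] T[v] T[x] forcing)
    allBut₂⇒T : ∀ x → lookup (allBut₂ u v) x ≡ false → lookup T x ≡ false
    allBut₂⇒T x white with allBut₂-white {a = u} {v} white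
    ... | inj₁ refl = T[u]
    ... | inj₂ refl = T[v]

  minimal⇒omitsTwo : ∀ {S} → MinimalSkewForcing G S → OmitsTwoFromDifferentParts part S
  minimal⇒omitsTwo {S} (forcing , minimal) with forcingShape S forcing
  ... | is⊤ refl = ⊥-elim (allBut≢⊤ vertex (minimal (allBut vertex) ⊆⊤ (allBut-forcing noIsolated vertex)))
  ... | isAllBut a refl with noIsolated a
  ...   | b , a~b = ⊥-elim (allBut₂≢allBut a≢b a
          (minimal (allBut₂ a b) (allBut₂⊆allBut a b) (allBut₂-forcing noIsolated a≢b (adj-sym a~b) (Graph.irrefl G b))))
    where
    a≢b : a ≢ b
    a≢b = adj⇒≢ a~b
  minimal⇒omitsTwo (forcing , minimal) | isAllBut₂ {a} {b} _ a~b refl = a , b , adj⇒different-parts a~b , refl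

  minimal⇔omitsTwo : ∀ S → MinimalSkewForcing G S ⇔ OmitsTwoFromDifferentParts part S
  minimal⇔omitsTwo S = mk⇔ minimal⇒omitsTwo λ { (u , v , pu≢pv , refl) → omitsTwo⇒forcing pu≢pv , omitsTwo⇒minimal pu≢pv }

  forcing∧size⇒omitsTwo : ∀ {S} → SkewForcing G S × ∣ S ∣ ≡ n ∸ 2 → OmitsTwoFromDifferentParts part S
  forcing∧size⇒omitsTwo {S} (forcing , ∣S∣≡n∸2) with forcingShape S forcing
  ... | is⊤ refl                  = ⊥-elim (n≢n∸2 2≤n (trans (sym (∣⊤∣≡n n)) ∣S∣≡n∸2))
    where
    n≢n∸2 : ∀ {m} → 2 ≤ m → m ≢ m ∸ 2
    n≢n∸2 {suc (suc k)} (s≤s (s≤s _)) = ≢-sym (m≢1+n+m k)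
  ... | isAllBut a refl           = ⊥-elim (n∸1≢n∸2 2≤n (trans (sym (∣allBut∣ a)) ∣S∣≡n∸2))
    where
    n∸1≢n∸2 : ∀ {m} → 2 ≤ m → m ∸ 1 ≢ m ∸ 2
    n∸1≢n∸2 {suc (suc k)} (s≤s (s≤s _)) = 1+n≢n
  ... | isAllBut₂ {a} {b} _ a~b refl = a , b , adj⇒different-parts a~b , refl

  forcing∧size⇔omitsTwo : ∀ S → (SkewForcing G S × ∣ S ∣ ≡ n ∸ 2) ⇔ OmitsTwoFromDifferentParts part S
  forcing∧size⇔omitsTwo S = mk⇔ forcing∧size⇒omitsTwo
    λ { (u , v , pu≢pv , refl) → omitsTwo⇒forcing pu≢pv , ∣allBut₂∣ (different-parts⇒≢ pu≢pv) }

  minimal⇒TARDegree : ∀ S → MinimalSkewForcing G S → TARDegree G S 2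
  minimal⇒TARDegree S minimal with minimal⇒omitsTwo minimal
  ... | u , v , pu≢pv , refl = allBut u ∷ allBut v ∷ [] , unique , refl , λ T → mk⇔ neighbour (listed T)
    where
    u≢v : u ≢ v
    u≢v = different-parts⇒≢ pu≢pv
    unique : Unique (allBut u ∷ allBut v ∷ [])
    unique = ((λ e → u≢v (allBut-injective e)) All.∷ All.[]) ∷ (All.[] ∷ [])
    neighbour : ∀ {T} → T ∈ₗ allBut u ∷ allBut v ∷ [] → SkewForcing G T × TARAdj (allBut₂ u v) T
    neighbour (here refl)         = allBut-forcing noIsolated u , TARAdj-sym (allBut u) (allBut₂ u v) (TARAdj-allBut-allBut₂ˡ u≢v)
    neighbour (there (here refl)) = allBut-forcing noIsolated v , TARAdj-allBut₂-allBut u≢v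
    listed : ∀ T → SkewForcing G T × TARAdj (allBut₂ u v) T → T ∈ₗ allBut u ∷ allBut v ∷ []
    listed T (forcing , adj) with allBut₂-forcing-TARAdj u≢v T forcing adj
    ... | inj₁ T≡allBut-u = here T≡allBut-u
    ... | inj₂ T≡allBut-v = there (here T≡allBut-v)

  size-n∸1⇒forcing : ∀ S → ∣ S ∣ ≡ n ∸ 1 → SkewForcing G S
  size-n∸1⇒forcing S ∣S∣≡n∸1 with ∣p∣≡n∸1⇒p≡allBut S (≤-trans (s≤s z≤n) 2≤n) ∣S∣≡n∸1
  ... | a , refl = allBut-forcing noIsolated a

  lookup-∁PartiteSet : ∀ c v → lookup (∁ (PartiteSet part (part v))) c ≡ not (part c ≡ᵇ part v)
  lookup-∁PartiteSet c v = trans (lookup-∁ (PartiteSet part (part v)) c) (cong not (lookup-PartiteSet (part v) c))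

  ∈∁PartiteSet⁺ : ∀ {c v} → part c ≢ part v → lookup (∁ (PartiteSet part (part v))) c ≡ true
  ∈∁PartiteSet⁺ {c} {v} pc≢pv = trans (lookup-∁PartiteSet c v) (cong not (≢⇒≡ᵇfalse pc≢pv))

  ∈∁PartiteSet⁻ : ∀ {c v} → lookup (∁ (PartiteSet part (part v))) c ≡ true → part c ≢ part v
  ∈∁PartiteSet⁻ {c} {v} c∈ pc≡pv = true≢false (trans (sym c∈) (trans (lookup-∁PartiteSet c v) (cong not (≡⇒≡ᵇtrue pc≡pv))))

  allBut-TARDegree : ∀ v → TARDegree G (allBut v) (n ∸ ns (part v) + 1)
  allBut-TARDegree v = neighbours , unique , size , λ T → mk⇔ neighbour (listed T)
    where
    others : Subset n
    others = ∁ (PartiteSet part (part v))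
    neighbours : List (Subset n)
    neighbours = ⊤ ∷ List.map (λ c → allBut₂ c v) (elements others)
    unique : Unique neighbours
    unique = All.map⁺ (All.tabulate (λ {c} _ ⊤≡allBut₂ → allBut₂≢⊤ c v (sym ⊤≡allBut₂)))
           ∷ Unique.map⁺ allBut₂-injectiveˡ (elements-unique others)
    size : length neighbours ≡ n ∸ ns (part v) + 1
    size = trans (cong suc (begin
      length (List.map (λ c → allBut₂ c v) (elements others))   ≡⟨ length-map _ (elements others) ⟩
      length (elements others)                                 ≡⟨ length-elements others ⟩
      ∣ others ∣                                               ≡⟨ ∣∁p∣≡n∸∣p∣ (PartiteSet part (part v)) ⟩
      n ∸ ∣ PartiteSet part (part v) ∣                          ≡⟨ cong (n ∸_) (proj₂ G-multipartite (part v)) ⟩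
      n ∸ ns (part v)                                          ∎)) (+-comm 1 (n ∸ ns (part v)))
      where open ≡-Reasoning
    neighbour : ∀ {T} → T ∈ₗ neighbours → SkewForcing G T × TARAdj (allBut v) T
    neighbour (here refl) = ε , TARAdj-allBut-⊤ v
    neighbour (there T∈) with ∈-map⁻ (λ c → allBut₂ c v) T∈
    ... | c , c∈ , refl = omitsTwo⇒forcing pc≢pv , TARAdj-allBut-allBut₂ʳ (different-parts⇒≢ pc≢pv)
      where
      pc≢pv : part c ≢ part v
      pc≢pv = ∈∁PartiteSet⁻ (∈-elements⁻ others c∈)
    listed : ∀ T → SkewForcing G T × TARAdj (allBut v) T → T ∈ₗ neighbours
    listed T (forcing , adj) with TARAdj-allBut v T adj
    ... | inj₁ refl = here refl
    ... | inj₂ (c , c≢v , refl) = there (∈-map⁺ (λ c → allBut₂ c v)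
      (∈-elements⁺ others (∈∁PartiteSet⁺ (adj⇒different-parts (allBut₂-forcing⇒adj c≢v forcing)))))

module TARIsomorphism {m n} (H : Graph m) (G : Graph n) (iso : TARIso H G) where

  to : Subset m → Subset n
  to = proj₁ iso

  from : Subset n → Subset m
  from = proj₁ (proj₂ iso)

  to-forcing : ∀ {S} → SkewForcing H S → SkewForcing G (to S)
  to-forcing {S} forcing = proj₁ (proj₁ (proj₂ (proj₂ iso)) S forcing)

  from-to : ∀ {S} → SkewForcing H S → from (to S) ≡ S
  from-to {S} forcing = proj₂ (proj₁ (proj₂ (proj₂ iso)) S forcing)

  from-forcing : ∀ {T} → SkewForcing G T → SkewForcing H (from T)
  from-forcing {T} forcing = proj₁ (proj₁ (proj₂ (proj₂ (proj₂ iso))) T forcing)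

  to-from : ∀ {T} → SkewForcing G T → to (from T) ≡ T
  to-from {T} forcing = proj₂ (proj₁ (proj₂ (proj₂ (proj₂ iso))) T forcing)

  to-TARAdj : ∀ {S S'} → SkewForcing H S → SkewForcing H S' → TARAdj S S' → TARAdj (to S) (to S')
  to-TARAdj {S} {S'} forcing forcing' = Equivalence.to (proj₂ (proj₂ (proj₂ (proj₂ iso))) S S' forcing forcing')

  to-TARAdj⁻ : ∀ {S S'} → SkewForcing H S → SkewForcing H S' → TARAdj (to S) (to S') → TARAdj S S'
  to-TARAdj⁻ {S} {S'} forcing forcing' = Equivalence.from (proj₂ (proj₂ (proj₂ (proj₂ iso))) S S' forcing forcing')

  to-injective : ∀ {S S'} → SkewForcing H S → SkewForcing H S' → to S ≡ to S' → S ≡ S'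
  to-injective {S} {S'} forcing forcing' e = trans (sym (from-to forcing)) (trans (cong from e) (from-to forcing'))

  inverse : TARIso G H
  inverse = from , to
    , (λ T forcing → from-forcing forcing , to-from forcing)
    , (λ S forcing → to-forcing forcing , from-to forcing)
    , λ T T' forcing forcing' → mk⇔
        (λ adj → to-TARAdj⁻ (from-forcing forcing) (from-forcing forcing')
                   (subst₂ TARAdj (sym (to-from forcing)) (sym (to-from forcing')) adj))
        (λ adj → subst₂ TARAdj (to-from forcing) (to-from forcing') (to-TARAdj (from-forcing forcing) (from-forcing forcing') adj))

  module _ (noIsolated : NoIsolatedVertices H) where
    open SkewForcingIn H using (allBut-forcing)

    to-allBut-differOnlyAt : ∀ x → ∃[ c ] DifferOnlyAt c (to ⊤) (to (allBut x))
    to-allBut-differOnlyAt x = TARAdj⇒differOnlyAt (to ⊤) (to (allBut x))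
      (to-TARAdj ε (allBut-forcing noIsolated x) (TARAdj-sym (allBut x) ⊤ (TARAdj-allBut-⊤ x)))

    vertexMap : Fin m → Fin n
    vertexMap x = proj₁ (to-allBut-differOnlyAt x)

    vertexMap-injective : ∀ {x y} → vertexMap x ≡ vertexMap y → x ≡ y
    vertexMap-injective {x} {y} e = allBut-injective (to-injective (allBut-forcing noIsolated x) (allBut-forcing noIsolated y)
      (differOnlyAt-unique (proj₂ (to-allBut-differOnlyAt x))
        (subst (λ c → DifferOnlyAt c (to ⊤) (to (allBut y))) (sym e) (proj₂ (to-allBut-differOnlyAt y)))))

TARIso⇒≡ : ∀ {m n} (H : Graph m) (G : Graph n) → NoIsolatedVertices H → NoIsolatedVertices G → TARIso H G → m ≡ n
TARIso⇒≡ H G noIsolatedH noIsolatedG iso = Fin.cantor-schröder-bernstein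
  (TARIsomorphism.vertexMap-injective H G iso noIsolatedH)
  (TARIsomorphism.vertexMap-injective G H (TARIsomorphism.inverse H G iso) noIsolatedG)

record TARDegree≥3 {n} (K : Graph n) (S : Subset n) : Set where
  constructor tarDegree≥3
  field
    forcing                    : SkewForcing K S
    {T₁ T₂ T₃}                 : Subset n
    forcing₁                   : SkewForcing K T₁
    forcing₂                   : SkewForcing K T₂
    forcing₃                   : SkewForcing K T₃
    T₁≢T₂                      : T₁ ≢ T₂
    T₁≢T₃                      : T₁ ≢ T₃
    T₂≢T₃                      : T₂ ≢ T₃
    adj₁                       : TARAdj S T₁
    adj₂                       : TARAdj S T₂
    adj₃                       : TARAdj S T₃

three-distinct-in-pair : ∀ {A : Set} {a b x₁ x₂ x₃ : A} → x₁ ≢ x₂ → x₁ ≢ x₃ → x₂ ≢ x₃ →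
  x₁ ≡ a ⊎ x₁ ≡ b → x₂ ≡ a ⊎ x₂ ≡ b → x₃ ≡ a ⊎ x₃ ≡ b → ⊥
three-distinct-in-pair x₁≢x₂ _ _ (inj₁ refl) (inj₁ refl) _ = x₁≢x₂ refl
three-distinct-in-pair x₁≢x₂ _ _ (inj₂ refl) (inj₂ refl) _ = x₁≢x₂ refl
three-distinct-in-pair _ x₁≢x₃ _ (inj₁ refl) _ (inj₁ refl) = x₁≢x₃ refl
three-distinct-in-pair _ x₁≢x₃ _ (inj₂ refl) _ (inj₂ refl) = x₁≢x₃ refl
three-distinct-in-pair _ _ x₂≢x₃ _ (inj₁ refl) (inj₁ refl) = x₂≢x₃ refl
three-distinct-in-pair _ _ x₂≢x₃ _ (inj₂ refl) (inj₂ refl) = x₂≢x₃ refl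

module _ {n} {K : Graph n} (noIsolated : NoIsolatedVertices K) where
  open SkewForcingIn K using (allBut-forcing)

  allBut-TARDegree≥3 : ∀ {a b c} → a ≢ b → a ≢ c → b ≢ c →
    SkewForcing K (allBut₂ a b) → SkewForcing K (allBut₂ a c) → TARDegree≥3 K (allBut a)
  allBut-TARDegree≥3 {a} {b} {c} a≢b a≢c b≢c forcing-ab forcing-ac =
    tarDegree≥3 (allBut-forcing noIsolated a) ε forcing-ab forcing-ac
      (≢-at a (lookup-⊤ a) (allBut₂-omitsˡ a b)) (≢-at a (lookup-⊤ a) (allBut₂-omitsˡ a c))
      (≢-at c (allBut₂-keeps (≢-sym a≢c) (≢-sym b≢c)) (allBut₂-omitsʳ a c))
      (TARAdj-allBut-⊤ a) (TARAdj-allBut-allBut₂ˡ a≢b) (TARAdj-allBut-allBut₂ˡ a≢c)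

  allBut₂-TARDegree≥3 : ∀ {a b c} → a ≢ b → c ≢ a → c ≢ b →
    SkewForcing K (allBut₂ a b) → SkewForcing K (allBut₃ c a b) → TARDegree≥3 K (allBut₂ a b)
  allBut₂-TARDegree≥3 {a} {b} {c} a≢b c≢a c≢b forcing forcing-cab =
    tarDegree≥3 forcing (allBut-forcing noIsolated a) (allBut-forcing noIsolated b) forcing-cab
      (≢-at b (allBut-keeps (≢-sym a≢b)) (allBut-omits b)) (≢-at b (allBut-keeps (≢-sym a≢b)) (allBut₃-omits₃ c a b))
      (≢-at a (allBut-keeps a≢b) (allBut₃-omits₂ c a b))
      (TARAdj-sym (allBut a) (allBut₂ a b) (TARAdj-allBut-allBut₂ˡ a≢b)) (TARAdj-allBut₂-allBut a≢b)
      (TARAdj-sym (allBut₃ c a b) (allBut₂ a b) (TARAdj-allBut₃-allBut₂ c≢a c≢b))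

module _ {n} {K : Graph n} (twins : NonAdjacentAreTwins K) where
  open TwinGraph K twins

  TARDegree≥3⇒⊤∨allBut : ∀ {X} → TARDegree≥3 K X → X ≡ ⊤ ⊎ ∃[ a ] X ≡ allBut a
  TARDegree≥3⇒⊤∨allBut {X} d with forcingShape X (TARDegree≥3.forcing d)
  ... | is⊤ X≡⊤          = inj₁ X≡⊤
  ... | isAllBut a X≡     = inj₂ (a , X≡)
  ... | isAllBut₂ a≢b _ refl = ⊥-elim (three-distinct-in-pair T₁≢T₂ T₁≢T₃ T₂≢T₃
          (allBut₂-forcing-TARAdj a≢b _ forcing₁ adj₁) (allBut₂-forcing-TARAdj a≢b _ forcing₂ adj₂)
          (allBut₂-forcing-TARAdj a≢b _ forcing₃ adj₃))
    where open TARDegree≥3 d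

  TARDegree≥3-TARAdj⇒⊤ : ∀ {X Y} → TARDegree≥3 K X → TARDegree≥3 K Y → TARAdj X Y → X ≡ ⊤ ⊎ Y ≡ ⊤
  TARDegree≥3-TARAdj⇒⊤ dX dY adj with TARDegree≥3⇒⊤∨allBut dX | TARDegree≥3⇒⊤∨allBut dY
  ... | inj₁ X≡⊤        | _               = inj₁ X≡⊤
  ... | inj₂ _          | inj₁ Y≡⊤        = inj₂ Y≡⊤
  ... | inj₂ (a , refl) | inj₂ (b , refl) with TARAdj-allBut a (allBut b) adj
  ...   | inj₁ allBut-b≡⊤        = ⊥-elim (allBut≢⊤ b allBut-b≡⊤)
  ...   | inj₂ (c , c≢a , e)     = ⊥-elim (allBut₂≢allBut c≢a b (sym e))

  disjoint-TARDegree≥3-edges⇒⊥ : ∀ {X Y Z W} → TARDegree≥3 K X → TARDegree≥3 K Y → TARDegree≥3 K Z → TARDegree≥3 K W →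
    TARAdj X Y → TARAdj Z W → X ≢ Z → X ≢ W → Y ≢ Z → Y ≢ W → ⊥
  disjoint-TARDegree≥3-edges⇒⊥ dX dY dZ dW X~Y Z~W X≢Z X≢W Y≢Z Y≢W
    with TARDegree≥3-TARAdj⇒⊤ dX dY X~Y | TARDegree≥3-TARAdj⇒⊤ dZ dW Z~W
  ... | inj₁ refl | inj₁ Z≡⊤ = X≢Z (sym Z≡⊤)
  ... | inj₁ refl | inj₂ W≡⊤ = X≢W (sym W≡⊤)
  ... | inj₂ refl | inj₁ Z≡⊤ = Y≢Z (sym Z≡⊤)
  ... | inj₂ refl | inj₂ W≡⊤ = Y≢W (sym W≡⊤)

module _ {m n} (H : Graph m) (G : Graph n) (iso : TARIso H G) where
  open TARIsomorphism H G iso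

  to-TARDegree≥3 : ∀ {S} → TARDegree≥3 H S → TARDegree≥3 G (to S)
  to-TARDegree≥3 (tarDegree≥3 forcing forcing₁ forcing₂ forcing₃ T₁≢T₂ T₁≢T₃ T₂≢T₃ adj₁ adj₂ adj₃) =
    tarDegree≥3 (to-forcing forcing) (to-forcing forcing₁) (to-forcing forcing₂) (to-forcing forcing₃)
      (λ e → T₁≢T₂ (to-injective forcing₁ forcing₂ e)) (λ e → T₁≢T₃ (to-injective forcing₁ forcing₃ e))
      (λ e → T₂≢T₃ (to-injective forcing₂ forcing₃ e))
      (to-TARAdj forcing forcing₁ adj₁) (to-TARAdj forcing forcing₂ adj₂) (to-TARAdj forcing forcing₃ adj₃)

  to-≢-at : ∀ {S S'} v → SkewForcing H S → SkewForcing H S' → lookup S v ≡ true → lookup S' v ≡ false → to S ≢ to S'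
  to-≢-at v forcing forcing' S[v] S'[v] e = ≢-at v S[v] S'[v] (to-injective forcing forcing' e)

module _ {m n} (H : Graph m) (G : Graph n) (iso : TARIso H G)
    (noIsolated : NoIsolatedVertices H) (twinsG : NonAdjacentAreTwins G) where
  open TARIsomorphism H G iso
  open SkewForcingIn H

  twin-violation⇒⊥ : ∀ {x y z} → adj H x y ≡ false → adj H z x ≡ true → adj H z y ≡ false → ⊥
  twin-violation⇒⊥ {x} {y} {z} x≁y z~x z≁y = disjoint-TARDegree≥3-edges⇒⊥ twinsG
    (to-TARDegree≥3 H G iso (allBut-TARDegree≥3 noIsolated x≢y x≢z y≢z forcing-xy forcing-xz))
    (to-TARDegree≥3 H G iso (allBut₂-TARDegree≥3 noIsolated x≢y z≢x z≢y forcing-xy forcing-zxy))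
    (to-TARDegree≥3 H G iso (allBut-TARDegree≥3 noIsolated z≢y z≢x y≢x forcing-zy forcing-zx))
    (to-TARDegree≥3 H G iso (allBut₂-TARDegree≥3 noIsolated z≢y x≢z x≢y forcing-zy forcing-xzy))
    (to-TARAdj (allBut-forcing noIsolated x) forcing-xy (TARAdj-allBut-allBut₂ˡ x≢y))
    (to-TARAdj (allBut-forcing noIsolated z) forcing-zy (TARAdj-allBut-allBut₂ˡ z≢y))
    (to-≢-at H G iso z (allBut-forcing noIsolated x) (allBut-forcing noIsolated z) (allBut-keeps z≢x) (allBut-omits z))
    (to-≢-at H G iso z (allBut-forcing noIsolated x) forcing-zy (allBut-keeps z≢x) (allBut₂-omitsˡ z y))
    (to-≢-at H G iso z forcing-xy (allBut-forcing noIsolated z) (allBut₂-keeps z≢x z≢y) (allBut-omits z))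
    (to-≢-at H G iso z forcing-xy forcing-zy (allBut₂-keeps z≢x z≢y) (allBut₂-omitsˡ z y))
    where
    x≢y : x ≢ y
    x≢y = adj-true-false⇒≢ z~x z≁y
    y≢x : y ≢ x
    y≢x = ≢-sym x≢y
    z≢x : z ≢ x
    z≢x = adj⇒≢ z~x
    x≢z : x ≢ z
    x≢z = ≢-sym z≢x
    z≢y : z ≢ y
    z≢y refl = true≢false (trans (sym z~x) (trans (Graph.sym H z x) x≁y))
    y≢z : y ≢ z
    y≢z = ≢-sym z≢y
    forcing-xy  : SkewForcing H (allBut₂ x y)
    forcing-xy  = allBut₂-forcing noIsolated x≢y z~x z≁y
    forcing-xz  : SkewForcing H (allBut₂ x z)
    forcing-xz  = allBut₂-forcing noIsolated x≢z z~x (Graph.irrefl H z)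
    forcing-zx  : SkewForcing H (allBut₂ z x)
    forcing-zx  = subst (SkewForcing H) (allBut₂-comm x z) forcing-xz
    forcing-zy  : SkewForcing H (allBut₂ z y)
    forcing-zy  = allBut₂-forcing noIsolated z≢y (adj-sym z~x) x≁y
    forcing-zxy : SkewForcing H (allBut₃ z x y)
    forcing-zxy = allBut₃-forcing z≢x z≢y (adj-sym z~x) (Graph.irrefl H x) x≁y forcing-xy
    forcing-xzy : SkewForcing H (allBut₃ x z y)
    forcing-xzy = subst (SkewForcing H) (allBut₃-swap z x y) forcing-zxy

  TARIso⇒twins : NonAdjacentAreTwins H
  TARIso⇒twins x y x≁y u with adj H u x in u~x | adj H u y in u~y
  ... | true  | true  = refl
  ... | false | false = refl
  ... | true  | false = ⊥-elim (twin-violation⇒⊥ x≁y u~x u~y)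
  ... | false | true  = ⊥-elim (twin-violation⇒⊥ (trans (Graph.sym H y x) x≁y) u~y u~x)

adjacency-bijection⇒GraphIso : ∀ {m n} (H : Graph m) (G : Graph n) (f : Fin m → Fin n) (g : Fin n → Fin m) →
  (∀ v → f (g v) ≡ v) → (∀ x → g (f x) ≡ x) →
  (∀ {u v} → adj H u v ≡ true → adj G (f u) (f v) ≡ true) → (∀ {u v} → adj G u v ≡ true → adj H (g u) (g v) ≡ true) →
  GraphIso H G
adjacency-bijection⇒GraphIso H G f g fg gf f-adj g-adj = mk↔ₛ′ f g fg gf , λ u v →
  ≡true⇔≡true⇒≡ f-adj (λ fu~fv → subst₂ (λ x y → adj H x y ≡ true) (gf u) (gf v) (g-adj fu~fv))

StarWithCentre : ∀ {n} → Graph n → Fin n → Set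
StarWithCentre K c = ∀ x y → x ≢ c → y ≢ c → adj K x y ≡ false

module _ {n} (K : Graph n) (noIsolated : NoIsolatedVertices K) {c : Fin n} (star : StarWithCentre K c) where

  star-leaf~centre : ∀ {x} → x ≢ c → adj K x c ≡ true
  star-leaf~centre {x} x≢c with noIsolated x
  ... | y , x~y with y ≟ c
  ...   | yes refl = x~y
  ...   | no y≢c   = ⊥-elim (true≢false (trans (sym x~y) (star x y x≢c y≢c)))

  star-adj : ∀ x y → adj K x y ≡ ((x ≡ᵇ c) xor (y ≡ᵇ c))
  star-adj x y with x ≟ c | y ≟ c
  ... | yes refl | yes refl = Graph.irrefl K x
  ... | yes refl | no y≢c   = trans (Graph.sym K x y) (star-leaf~centre y≢c)
  ... | no x≢c   | yes refl = star-leaf~centre x≢c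
  ... | no x≢c   | no y≢c   = star x y x≢c y≢c

transpose-≡ᵇ : ∀ {n} (i j k : Fin n) → (Perm.transpose i j ⟨$⟩ʳ k ≡ᵇ j) ≡ (k ≡ᵇ i)
transpose-≡ᵇ i j k with k ≟ i
... | yes refl = ≡ᵇ-refl j
... | no k≢i with k ≟ j
...   | yes refl = ≢⇒≡ᵇfalse (≢-sym k≢i)
...   | no k≢j   = ≢⇒≡ᵇfalse k≢j

stars⇒GraphIso : ∀ {n} (H G : Graph n) → NoIsolatedVertices H → NoIsolatedVertices G →
  ∀ {c d} → StarWithCentre H c → StarWithCentre G d → GraphIso H G
stars⇒GraphIso H G noIsolatedH noIsolatedG {c} {d} starH starG = Perm.transpose c d , λ u v → begin
  adj H u v                                                          ≡⟨ star-adj H noIsolatedH starH u v ⟩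
  (u ≡ᵇ c) xor (v ≡ᵇ c)                                              ≡⟨ cong₂ _xor_ (transpose-≡ᵇ c d u) (transpose-≡ᵇ c d v) ⟨
  (Perm.transpose c d ⟨$⟩ʳ u ≡ᵇ d) xor (Perm.transpose c d ⟨$⟩ʳ v ≡ᵇ d) ≡⟨ star-adj G noIsolatedG starG _ _ ⟨
  adj G (Perm.transpose c d ⟨$⟩ʳ u) (Perm.transpose c d ⟨$⟩ʳ v)        ∎
  where open ≡-Reasoning

-- A graph without isolated vertices on at most two vertices is empty or K₂.
small⇒GraphIso : ∀ {n} (H G : Graph n) → NoIsolatedVertices H → NoIsolatedVertices G →
  (∀ (x y z : Fin n) → x ≢ y → x ≢ z → y ≢ z → ⊥) → GraphIso H G
small⇒GraphIso {zero}        H G _ _ _ = Perm.id , λ ()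
small⇒GraphIso {suc zero}    H G noIsolatedH _ _ with noIsolatedH zero
... | zero , 0~0 = ⊥-elim (true≢false (trans (sym 0~0) (Graph.irrefl H zero)))
small⇒GraphIso {suc (suc zero)} H G noIsolatedH noIsolatedG _ =
  Perm.id , λ u v → trans (K₂ H noIsolatedH u v) (sym (K₂ G noIsolatedG u v))
  where
  0~1 : (K : Graph 2) → NoIsolatedVertices K → adj K zero (suc zero) ≡ true
  0~1 K noIsolated with noIsolated zero
  ... | zero     , 0~0 = ⊥-elim (true≢false (trans (sym 0~0) (Graph.irrefl K zero)))
  ... | suc zero , 0~1 = 0~1
  K₂ : (K : Graph 2) → NoIsolatedVertices K → ∀ u v → adj K u v ≡ not (u ≡ᵇ v)
  K₂ K _          zero       zero       = Graph.irrefl K zero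
  K₂ K _          (suc zero) (suc zero) = Graph.irrefl K (suc zero)
  K₂ K noIsolated zero       (suc zero) = 0~1 K noIsolated
  K₂ K noIsolated (suc zero) zero       = trans (Graph.sym K (suc zero) zero) (0~1 K noIsolated)
small⇒GraphIso {suc (suc (suc n))} H G _ _ no-three = ⊥-elim (no-three zero (suc zero) (suc (suc zero)) (λ ()) (λ ()) (λ ()))

module Reconstruction {m n} (H : Graph m) (G : Graph n) (iso : TARIso H G)
    (noIsolatedH : NoIsolatedVertices H) (twinsG : NonAdjacentAreTwins G) where
  open TARIsomorphism H G iso
  open SkewForcingIn H using (allBut-forcing; allBut₂-forcing; adj⇒≢; adj-sym)
  open TwinGraph G twinsG

  allBut-forcingH : ∀ x → SkewForcing H (allBut x)
  allBut-forcingH = allBut-forcing noIsolatedH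

  adj⇒allBut₂-forcing : ∀ {x y} → adj H x y ≡ true → SkewForcing H (allBut₂ x y)
  adj⇒allBut₂-forcing {x} {y} x~y = allBut₂-forcing noIsolatedH (adj⇒≢ x~y) (adj-sym x~y) (Graph.irrefl H y)

  to⊤-TARAdj-to-allBut : ∀ x → TARAdj (to ⊤) (to (allBut x))
  to⊤-TARAdj-to-allBut x = to-TARAdj ε (allBut-forcingH x) (TARAdj-sym (allBut x) ⊤ (TARAdj-allBut-⊤ x))

  to-allBut-injective : ∀ {x y} → to (allBut x) ≡ to (allBut y) → x ≡ y
  to-allBut-injective e = allBut-injective (to-injective (allBut-forcingH _) (allBut-forcingH _) e)

  to-allBut₂≢to⊤ : ∀ {x y} → adj H x y ≡ true → to (allBut₂ x y) ≢ to ⊤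
  to-allBut₂≢to⊤ {x} {y} x~y e = allBut₂≢⊤ x y (to-injective (adj⇒allBut₂-forcing x~y) ε e)

  module Fixing⊤ (to⊤ : to ⊤ ≡ ⊤) where

    vertexMap-spec : ∀ x → ∃[ c ] to (allBut x) ≡ allBut c
    vertexMap-spec x = TARAdj-⊤ (to (allBut x)) (subst (λ S → TARAdj S (to (allBut x))) to⊤ (to⊤-TARAdj-to-allBut x))

    π : Fin m → Fin n
    π x = proj₁ (vertexMap-spec x)

    to-allBut : ∀ x → to (allBut x) ≡ allBut (π x)
    to-allBut x = proj₂ (vertexMap-spec x)

    -- to (allBut₂ x y) is a TAR neighbour of allBut (π x) and of allBut (π y) other than ⊤, so it omits π x and π y.
    π-adj : ∀ {x y} → adj H x y ≡ true → adj G (π x) (π y) ≡ true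
    π-adj {x} {y} x~y = trans (Graph.sym G (π x) (π y))
      (allBut₂-forcing⇒adj (≢-sym πx≢πy) (subst (SkewForcing G) F≡allBut₂ (to-forcing forcing-xy)))
      where
      x≢y : x ≢ y
      x≢y = adj⇒≢ x~y
      πx≢πy : π x ≢ π y
      πx≢πy e = x≢y (to-allBut-injective (trans (to-allBut x) (trans (cong allBut e) (sym (to-allBut y)))))
      forcing-xy : SkewForcing H (allBut₂ x y)
      forcing-xy = adj⇒allBut₂-forcing x~y
      F : Subset n
      F = to (allBut₂ x y)
      F≢⊤ : F ≢ ⊤
      F≢⊤ e = to-allBut₂≢to⊤ x~y (trans e (sym to⊤))
      allBut-πx~F : TARAdj (allBut (π x)) F
      allBut-πx~F = subst (λ S → TARAdj S F) (to-allBut x) (to-TARAdj (allBut-forcingH x) forcing-xy (TARAdj-allBut-allBut₂ˡ x≢y))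
      allBut-πy~F : TARAdj (allBut (π y)) F
      allBut-πy~F = subst (λ S → TARAdj S F) (to-allBut y) (to-TARAdj (allBut-forcingH y) forcing-xy (TARAdj-allBut-allBut₂ʳ x≢y))
      F≡allBut₂ : F ≡ allBut₂ (π y) (π x)
      F≡allBut₂ = [ (λ F≡⊤ → ⊥-elim (F≢⊤ F≡⊤)) , (λ F≡allBut₂ → F≡allBut₂) ]′
        (common-TARAdj-allBut πx≢πy F allBut-πx~F allBut-πy~F)

  module Moving⊤ToAllBut (w : Fin n) (to⊤ : to ⊤ ≡ allBut w) where
    open TARIsomorphism G H inverse using () renaming (to-TARAdj to from-TARAdj)

    from⊤-spec : ∃[ x₀ ] from ⊤ ≡ allBut x₀
    from⊤-spec = TARAdj-⊤ (from ⊤) (subst (λ S → TARAdj S (from ⊤)) from-allBut-w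
      (from-TARAdj (subst (SkewForcing G) to⊤ (to-forcing ε)) ε (TARAdj-allBut-⊤ w)))
      where
      from-allBut-w : from (allBut w) ≡ ⊤
      from-allBut-w = trans (cong from (sym to⊤)) (from-to ε)

    centre : Fin m
    centre = proj₁ from⊤-spec

    to-allBut-centre : to (allBut centre) ≡ ⊤
    to-allBut-centre = trans (cong to (sym (proj₂ from⊤-spec))) (to-from ε)

    leaf-image : ∀ {x} → x ≢ centre → ∃[ a ] (a ≢ w × to (allBut x) ≡ allBut₂ a w)
    leaf-image {x} x≢centre =
      [ (λ to-allBut-x≡⊤ → ⊥-elim (x≢centre (to-allBut-injective (trans to-allBut-x≡⊤ (sym to-allBut-centre)))))
      , (λ image → image) ]′
      (TARAdj-allBut w (to (allBut x)) (subst (λ S → TARAdj S (to (allBut x))) to⊤ (to⊤-TARAdj-to-allBut x)))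

    -- to (allBut₂ x y) would be a forcing TAR neighbour of allBut₂ a w and allBut₂ b w other than allBut w = to ⊤,
    -- so allBut a = allBut b.
    adjacent-leaves⇒≡ : ∀ {x y} → adj H x y ≡ true →
      ∃[ a ] (a ≢ w × to (allBut x) ≡ allBut₂ a w) → ∃[ b ] (b ≢ w × to (allBut y) ≡ allBut₂ b w) → x ≡ y
    adjacent-leaves⇒≡ {x} {y} x~y (a , a≢w , to-allBut-x) (b , b≢w , to-allBut-y) = to-allBut-injective (begin
      to (allBut x)    ≡⟨ to-allBut-x ⟩
      allBut₂ a w      ≡⟨ cong (λ c → allBut₂ c w) (allBut-injective (trans (sym F≡allBut-a) F≡allBut-b)) ⟩
      allBut₂ b w      ≡⟨ to-allBut-y ⟨
      to (allBut y)    ∎)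
      where
      open ≡-Reasoning
      forcing-xy : SkewForcing H (allBut₂ x y)
      forcing-xy = adj⇒allBut₂-forcing x~y
      F : Subset n
      F = to (allBut₂ x y)
      x≢y : x ≢ y
      x≢y = adj⇒≢ x~y
      allBut-x~F : TARAdj (allBut x) (allBut₂ x y)
      allBut-x~F = TARAdj-allBut-allBut₂ˡ x≢y
      allBut-y~F : TARAdj (allBut y) (allBut₂ x y)
      allBut-y~F = TARAdj-allBut-allBut₂ʳ x≢y
      image-of : ∀ {c v} → c ≢ w → to (allBut v) ≡ allBut₂ c w → TARAdj (allBut v) (allBut₂ x y) → F ≡ allBut c
      image-of {c} {v} c≢w to-allBut-v allBut-v~xy =
        [ (λ F≡allBut-c → F≡allBut-c) , (λ F≡allBut-w → ⊥-elim (to-allBut₂≢to⊤ x~y (trans F≡allBut-w (sym to⊤)))) ]′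
        (allBut₂-forcing-TARAdj c≢w F (to-forcing forcing-xy)
          (subst (λ S → TARAdj S F) to-allBut-v (to-TARAdj (allBut-forcingH v) forcing-xy allBut-v~xy)))
      F≡allBut-a : F ≡ allBut a
      F≡allBut-a = image-of a≢w to-allBut-x allBut-x~F
      F≡allBut-b : F ≡ allBut b
      F≡allBut-b = image-of b≢w to-allBut-y allBut-y~F

    star : StarWithCentre H centre
    star x y x≢centre y≢centre =
      ¬-not (λ x~y → adj⇒≢ x~y (adjacent-leaves⇒≡ x~y (leaf-image x≢centre) (leaf-image y≢centre)))

  no-three-vertices : ∀ {a b} → a ≢ b → to ⊤ ≡ allBut₂ a b → ∀ (x y z : Fin m) → x ≢ y → x ≢ z → y ≢ z → ⊥
  no-three-vertices {a} {b} a≢b to⊤ x y z x≢y x≢z y≢z = three-distinct-in-pair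
    (λ e → x≢y (to-allBut-injective e)) (λ e → x≢z (to-allBut-injective e)) (λ e → y≢z (to-allBut-injective e))
    (image x) (image y) (image z)
    where
    image : ∀ v → to (allBut v) ≡ allBut a ⊎ to (allBut v) ≡ allBut b
    image v = allBut₂-forcing-TARAdj a≢b (to (allBut v)) (to-forcing (allBut-forcingH v))
      (subst (λ S → TARAdj S (to (allBut v))) to⊤ (to⊤-TARAdj-to-allBut v))

module _ {m n} (H : Graph m) (G : Graph n) (noIsolatedH : NoIsolatedVertices H) (noIsolatedG : NoIsolatedVertices G)
    (twinsG : NonAdjacentAreTwins G) (iso : TARIso H G) where
  open TARIsomorphism H G iso
  open TwinGraph G twinsG using (ForcingShape; forcingShape; is⊤; isAllBut; isAllBut₂)

  private
    twinsH : NonAdjacentAreTwins H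
    twinsH = TARIso⇒twins H G iso noIsolatedH twinsG

    fixing⊤⇒GraphIso : to ⊤ ≡ ⊤ → GraphIso H G
    fixing⊤⇒GraphIso to⊤ = adjacency-bijection⇒GraphIso H G HG.π GH.π HG∘GH GH∘HG HG.π-adj GH.π-adj
      where
      open ≡-Reasoning
      module HG = Reconstruction.Fixing⊤ H G iso noIsolatedH twinsG to⊤
      module GH = Reconstruction.Fixing⊤ G H inverse noIsolatedG twinsH (trans (cong from (sym to⊤)) (from-to ε))
      HG∘GH : ∀ v → HG.π (GH.π v) ≡ v
      HG∘GH v = allBut-injective (begin
        allBut (HG.π (GH.π v))   ≡⟨ HG.to-allBut (GH.π v) ⟨
        to (allBut (GH.π v))     ≡⟨ cong to (GH.to-allBut v) ⟨
        to (from (allBut v))     ≡⟨ to-from (SkewForcingIn.allBut-forcing G noIsolatedG v) ⟩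
        allBut v                 ∎)
      GH∘HG : ∀ x → GH.π (HG.π x) ≡ x
      GH∘HG x = allBut-injective (begin
        allBut (GH.π (HG.π x))   ≡⟨ GH.to-allBut (HG.π x) ⟨
        from (allBut (HG.π x))   ≡⟨ cong from (HG.to-allBut x) ⟨
        from (to (allBut x))     ≡⟨ from-to (SkewForcingIn.allBut-forcing H noIsolatedH x) ⟩
        allBut x                 ∎)

    byShape : ForcingShape (to ⊤) → m ≡ n → GraphIso H G
    byShape (is⊤ to⊤)               _    = fixing⊤⇒GraphIso to⊤
    byShape (isAllBut w to⊤)        refl = stars⇒GraphIso H G noIsolatedH noIsolatedG HG.star GH.star
      where
      module HG = Reconstruction.Moving⊤ToAllBut H G iso noIsolatedH twinsG w to⊤
      module GH = Reconstruction.Moving⊤ToAllBut G H inverse noIsolatedG twinsH HG.centre (proj₂ HG.from⊤-spec)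
    byShape (isAllBut₂ a≢b _ to⊤)   refl =
      small⇒GraphIso H G noIsolatedH noIsolatedG (Reconstruction.no-three-vertices H G iso noIsolatedH twinsG a≢b to⊤)

  TARIso⇒GraphIso : GraphIso H G
  TARIso⇒GraphIso = byShape (forcingShape (to ⊤) (to-forcing ε)) (TARIso⇒≡ H G noIsolatedH noIsolatedG iso)

theorem5p3 : (t : ℕ) → 2 ≤ t → (ns : Fin t → ℕ) → (∀ i → 1 ≤ ns i) →
    (n : ℕ) → (G : Graph n) → (part : Fin n → Fin t) →
    IsCompleteMultipartite G part ns →
    ((∀ S → MinimalSkewForcing G S ⇔ OmitsTwoFromDifferentParts part S)
    × (∀ S → (SkewForcing G S × ∣ S ∣ ≡ n ∸ 2) ⇔ OmitsTwoFromDifferentParts part S)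
    × (∀ S → MinimalSkewForcing G S → TARDegree G S 2)
    × (∀ S → ∣ S ∣ ≡ n ∸ 1 → SkewForcing G S)
    × (∀ v → TARDegree G (∁ ⁅ v ⁆) (n ∸ ns (part v) + 1))
    × (∀ (m : ℕ) (H : Graph m) → NoIsolatedVertices H → TARIso H G → GraphIso H G))
theorem5p3 t 2≤t ns 1≤ns n G part G-multipartite =
  minimal⇔omitsTwo , forcing∧size⇔omitsTwo , minimal⇒TARDegree , size-n∸1⇒forcing , allBut-TARDegree ,
  λ m H noIsolatedH iso → TARIso⇒GraphIso H G noIsolatedH noIsolated twins iso
  where open CompleteMultipartite 2≤t ns 1≤ns G part G-multipartite
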